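{- Let $G$ be a spider with $d\ge 3$ legs. Then $d+1\le \chi_{la}(G)\le d+2$.
   Context: All graphs are finite, simple and connected. For a graph $G=(V,E)$ with $q=|E|$ edges, a local antimagic labeling of $G$ is a bijection $f:E\to\{1,\dots,q\}$ such that $f^+(x)\ne f^+(y)$ for every pair of adjacent vertices $x,y$, where $f^+(x)=\sum_{e\ni x} f(e)$ is the sum of the labels of the edges incident to $x$. The local antimagic chromatic number $\chi_{la}(G)$ is the minimum, over all local antimagic labelings $f$ of $G$, of the number of distinct values taken by $f^+$. For $d\ge 3$ and integers $y_1,\dots,y_d\ge 1$, the spider $Sp(y_1,\dots,y_d)$ (a spider with $d$ legs) is the tree obtained from $d$ paths of lengths (numbers of edges) $y_1,\dots,y_d$ by identifying one end-vertex of each path into a single vertex (the core, of degree $d$); these paths are its legs. -}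

module Defs where

open import Data.Nat using (ℕ; zero; suc; _+_; _≤_; _≟_)
open import Data.Nat.Properties using ()
open import Data.Nat.ListAction using (sum)
open import Data.Fin using (Fin; toℕ)
open import Data.List using (List; []; _∷_; _++_; length; map; upTo; allFin; lookup; deduplicate)
open import Data.List.Relation.Unary.All using (All)
open import Data.Product using (_×_; _,_; proj₁; proj₂; Σ; ∃)
open import Relation.Binary.PropositionalEquality using (_≡_; _≢_)
open import Relation.Nullary using (Dec; yes; no)
open import Function.Bundles using (_⤖_; Bijection)

-- A finite graph: vertices 0 , … , n-1 and a list of edges (pairs of vertices).
record Graph : Set where
  constructor mkGraph
  field
    nV    : ℕ
    edges : List (ℕ × ℕ)
open Graph public

numEdges : Graph → ℕ
numEdges G = length (edges G)

edgeAt : (G : Graph) → Fin (numEdges G) → ℕ × ℕ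
edgeAt G e = lookup (edges G) e

-- An edge labelling by {1,…,q}: a bijection σ of Fin q; edge e gets label 1 + σ e.
EdgeLabeling : Graph → Set
EdgeLabeling G = Fin (numEdges G) ⤖ Fin (numEdges G)

label : (G : Graph) → EdgeLabeling G → Fin (numEdges G) → ℕ
label G σ e = suc (toℕ (Bijection.to σ e))

incidentContribution : (G : Graph) → EdgeLabeling G → ℕ → Fin (numEdges G) → ℕ
incidentContribution G σ x e with proj₁ (edgeAt G e) ≟ x | proj₂ (edgeAt G e) ≟ x
... | yes _ | _     = label G σ e
... | no _  | yes _ = label G σ e
... | no _  | no _  = 0

vertexSum : (G : Graph) → EdgeLabeling G → ℕ → ℕ
vertexSum G σ x = sum (map (incidentContribution G σ x) (allFin (numEdges G)))

IsLocalAntimagic : (G : Graph) → EdgeLabeling G → Set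
IsLocalAntimagic G σ = (e : Fin (numEdges G)) →
  vertexSum G σ (proj₁ (edgeAt G e)) ≢ vertexSum G σ (proj₂ (edgeAt G e))

numColors : (G : Graph) → EdgeLabeling G → ℕ
numColors G σ = length (deduplicate _≟_ (map (vertexSum G σ) (upTo (nV G))))

IsChiLa : Graph → ℕ → Set
IsChiLa G k =
  (Σ (EdgeLabeling G) λ σ → IsLocalAntimagic G σ × numColors G σ ≡ k) ×
  ((σ : EdgeLabeling G) → IsLocalAntimagic G σ → k ≤ numColors G σ)

pathEdges : ℕ → ℕ → ℕ → List (ℕ × ℕ)
pathEdges a b zero    = []
pathEdges a b (suc k) = (a , b) ∷ pathEdges b (suc b) k

-- legs attached to core 0; a leg of length y at offset off uses vertices off+1 … off+y
spiderEdges : ℕ → List ℕ → List (ℕ × ℕ)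
spiderEdges off []       = []
spiderEdges off (y ∷ ys) = pathEdges 0 (suc off) y ++ spiderEdges (off + y) ys

Spider : List ℕ → Graph
Spider ys = mkGraph (suc (sum ys)) (spiderEdges 0 ys)

PositiveLegs : List ℕ → Set
PositiveLegs ys = All (λ y → 1 ≤ y) ys

module Submission where

-- Lower bound: the d leaves of a spider carry pairwise distinct sums, namely the labels of their
-- pendant edges, all at most q (the number of edges), while the inner end of the edge labelled q
-- has a sum exceeding q: d + 1 colours.
--
-- Upper bound: list the edges by a permutation τ that runs backwards along every leg and give the
-- edge at position m the label 1 + zigzag m, where zigzag sends 1, 3, 5, … to 0, 1, 2, … and
-- 0, 2, 4, … to q - 1, q - 2, …. Every internal vertex then sums to q or q + 1, alternately along a
-- leg, and q is also the sum at the leaf of the edge labelled q, so besides the d leaf sums only the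
-- core and q + 1 occur. The labelling is local antimagic unless the core sum equals the sum of an
-- internal neighbour, i.e. is q or q + 1. The global reversal and the leg-wise reversal of the
-- edges both qualify as τ; if both failed, the two core sums would be at most q + 1 each, whereas
-- twice their total, counted leg by leg, is at least (d + 1) q plus parity penalties: impossible
-- for d ≥ 4, and for d = 3 by a parity case analysis.
--
-- Since whether d + 1 colours can be attained is decidable (there are finitely many labellings),
-- χ_la is either d + 1 or d + 2.

open import Defs
open import Data.Nat
open import Data.Nat.Properties
open import Data.Nat.ListAction using (sum)
open import Data.Nat.Tactic.RingSolver using (solve-∀)
open import Data.Parity.Base using (Parity; 0ℙ; 1ℙ)
import Data.Parity.Base as ℙ
import Data.Parity.Properties as ℙ
open import Data.Fin using (Fin; zero; suc; toℕ; fromℕ<)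
import Data.Fin as Fin
open import Data.Fin.Properties using (toℕ<n; toℕ-fromℕ<; fromℕ<-toℕ; toℕ-injective; any?; all?)
open import Data.List using (List; []; _∷_; _++_; length; map; upTo; allFin; lookup; tabulate; deduplicate)
open import Data.List.Properties using (length-++; length-map; map-++; map-∘; map-cong; map-cong-local; map-tabulate; tabulate-cong)
open import Data.List.Membership.Propositional using (_∈_)
open import Data.List.Membership.Propositional.Properties
  using (∈-++⁻; ∈-++⁺ˡ; ∈-++⁺ʳ; ∈-∃++; ∈-map⁺; ∈-map⁻; ∈-upTo⁺; ∈-upTo⁻; ∈-deduplicate⁺; ∈-deduplicate⁻)
open import Data.List.Relation.Unary.All using (All; []; _∷_)
import Data.List.Relation.Unary.All as All
open import Data.List.Relation.Unary.Any using (here; there)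
open import Data.List.Relation.Unary.AllPairs using ([]; _∷_)
open import Data.List.Relation.Unary.Unique.Propositional using (Unique)
open import Data.List.Relation.Unary.Unique.DecPropositional.Properties using (deduplicate-!)
import Data.Vec.Functional as Vector
open import Data.Product using (Σ; ∃; _×_; _,_; proj₁; proj₂)
open import Data.Sum using (_⊎_; inj₁; inj₂)
open import Data.Empty using (⊥; ⊥-elim)
open import Function using (_∘_)
open import Function.Bundles using (_⤖_; Bijection; mk⤖)
open import Relation.Binary.PropositionalEquality
open import Relation.Nullary using (Dec; yes; no; ¬_)
open import Relation.Nullary.Decidable using (map′; ¬?; _×-dec_)

Unique-length-≤ : ∀ {xs ys : List ℕ} → Unique xs → (∀ {z} → z ∈ xs → z ∈ ys) → length xs ≤ length ys
Unique-length-≤ {[]} _ _ = z≤n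
Unique-length-≤ {x ∷ xs} (x∉xs ∷ u) xs⊆ys with ∈-∃++ (xs⊆ys (here refl))
... | us , vs , refl = begin
  suc (length xs)          ≤⟨ s≤s (Unique-length-≤ u (λ z∈xs → drop-x (xs⊆ys (there z∈xs)) (≢x z∈xs))) ⟩
  suc (length (us ++ vs))  ≡⟨ cong suc (length-++ us) ⟩
  suc (length us + length vs) ≡⟨ sym (+-suc (length us) (length vs)) ⟩
  length us + length (x ∷ vs) ≡⟨ sym (length-++ us) ⟩
  length (us ++ x ∷ vs)    ∎
  where
  open ≤-Reasoning
  ≢x : ∀ {z} → z ∈ xs → z ≢ x
  ≢x z∈xs z≡x = All.lookup x∉xs z∈xs (sym z≡x)
  drop-x : ∀ {z} → z ∈ us ++ x ∷ vs → z ≢ x → z ∈ us ++ vs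
  drop-x z∈ z≢x with ∈-++⁻ us z∈
  ... | inj₁ z∈us         = ∈-++⁺ˡ z∈us
  ... | inj₂ (here z≡x)   = ⊥-elim (z≢x z≡x)
  ... | inj₂ (there z∈vs) = ∈-++⁺ʳ us z∈vs

Unique-map⁺ : ∀ {P : ℕ → Set} (h : ℕ → ℕ) → (∀ {a b} → P a → P b → a ≢ b → h a ≢ h b) →
  ∀ {xs} → All P xs → Unique xs → Unique (map h xs)
Unique-map⁺ h inj {[]} _ _ = []
Unique-map⁺ h inj {x ∷ xs} (px ∷ ps) (x∉xs ∷ u) = apart ps x∉xs ∷ Unique-map⁺ h inj ps u
  where
  apart : ∀ {ys} → All _ ys → All (x ≢_) ys → All (h x ≢_) (map h ys)
  apart [] [] = []
  apart (py ∷ pys) (x≢y ∷ x≢ys) = inj px py x≢y ∷ apart pys x≢ys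

sum-map-+ : ∀ {A : Set} (f g : A → ℕ) xs → sum (map (λ x → f x + g x) xs) ≡ sum (map f xs) + sum (map g xs)
sum-map-+ f g []       = refl
sum-map-+ f g (x ∷ xs) = trans (cong (f x + g x +_) (sum-map-+ f g xs)) (+-assoc-swap (f x) (g x) _ _)
  where
  +-assoc-swap : ∀ a b c d → a + b + (c + d) ≡ a + c + (b + d)
  +-assoc-swap = solve-∀

sum-map-const : ∀ {A : Set} c (xs : List A) → sum (map (λ _ → c) xs) ≡ length xs * c
sum-map-const c []       = refl
sum-map-const c (x ∷ xs) = cong (c +_) (sum-map-const c xs)

sum-map-mono-≤ : ∀ {A : Set} {f g : A → ℕ} xs → (∀ {x} → x ∈ xs → f x ≤ g x) → sum (map f xs) ≤ sum (map g xs)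
sum-map-mono-≤ []       _  = z≤n
sum-map-mono-≤ (x ∷ xs) f≤g = +-mono-≤ (f≤g (here refl)) (sum-map-mono-≤ xs (f≤g ∘ there))

∈⇒≤sum : ∀ {x xs} → x ∈ xs → x ≤ sum xs
∈⇒≤sum {xs = y ∷ ys} (here refl) = m≤m+n y (sum ys)
∈⇒≤sum {xs = y ∷ ys} (there x∈) = ≤-trans (∈⇒≤sum x∈) (m≤n+m (sum ys) y)

∈⇒<sum : ∀ {x xs} → All (0 <_) xs → x ∈ xs → 2 ≤ length xs → x < sum xs
∈⇒<sum {x} {_ ∷ y ∷ ys} (_ ∷ 0<y ∷ _) (here refl) _ =
  subst (_≤ sum (x ∷ y ∷ ys)) (+-comm x 1) (+-monoʳ-≤ x (≤-trans 0<y (m≤m+n y (sum ys))))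
∈⇒<sum {x} {w ∷ ys} (0<w ∷ _) (there x∈) _ = +-mono-≤ 0<w (∈⇒≤sum x∈)
∈⇒<sum {xs = _ ∷ []} _ (here _) (s≤s ())

-- Parity and the zigzag permutation

data EvenOdd : ℕ → Set where
  even : ∀ t → EvenOdd (t + t)
  odd  : ∀ t → EvenOdd (suc (t + t))

evenOdd : ∀ m → EvenOdd m
evenOdd zero = even 0
evenOdd (suc m) with evenOdd m
... | even t = odd t
... | odd t  = subst EvenOdd (cong suc (+-suc t t)) (even (suc t))

parity-even : ∀ t → parity (t + t) ≡ 0ℙ
parity-even zero    = refl
parity-even (suc t) rewrite +-suc t t = parity-even t

parity-odd : ∀ t → parity (suc (t + t)) ≡ 1ℙ
parity-odd zero    = refl
parity-odd (suc t) rewrite +-suc t t = parity-odd t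

parity-suc≢ : ∀ n → parity (suc n) ≢ parity n
parity-suc≢ zero          ()
parity-suc≢ (suc zero)    ()
parity-suc≢ (suc (suc n)) = parity-suc≢ n

residue : Parity → ℕ
residue 0ℙ = 0
residue 1ℙ = 1

residue-≤ : ∀ π → residue π ≤ 1
residue-≤ 0ℙ = z≤n
residue-≤ 1ℙ = ≤-refl

residue-injective : ∀ {π π′} → residue π ≡ residue π′ → π ≡ π′
residue-injective {0ℙ} {0ℙ} _ = refl
residue-injective {1ℙ} {1ℙ} _ = refl

parity-+-≡ : ∀ m n {π π′} → parity m ≡ π → parity n ≡ π′ → parity (m + n) ≡ π ℙ.+ π′
parity-+-≡ m n refl refl = ℙ.+-homo-+ m n

parity-suc-≡ : ∀ n {π} → parity n ≡ π → parity (suc n) ≡ π ℙ.⁻¹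
parity-suc-≡ n refl = ℙ.+-homo-+ 1 n

∸-suc-involutive : ∀ {q v} → v < q → q ∸ suc (q ∸ suc v) ≡ v
∸-suc-involutive {suc q} (s≤s v≤q) = m∸[m∸n]≡n v≤q

∸-suc-< : ∀ {q} v → 0 < q → q ∸ suc v < q
∸-suc-< {suc q} v _ = s≤s (m∸n≤m q v)

∸-suc-step : ∀ {y j} → suc j < y → y ∸ suc j ≡ suc (y ∸ suc (suc j))
∸-suc-step {suc (suc y)} {zero}  _         = refl
∸-suc-step {suc y}       {suc j} (s≤s j<) = ∸-suc-step j<

⌊n/2⌋+⌊n/2⌋≤n : ∀ n → ⌊ n /2⌋ + ⌊ n /2⌋ ≤ n
⌊n/2⌋+⌊n/2⌋≤n zero          = z≤n
⌊n/2⌋+⌊n/2⌋≤n (suc zero)    = z≤n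
⌊n/2⌋+⌊n/2⌋≤n (suc (suc n)) rewrite +-suc ⌊ n /2⌋ ⌊ n /2⌋ = s≤s (s≤s (⌊n/2⌋+⌊n/2⌋≤n n))

n≤1+⌊n/2⌋+⌊n/2⌋ : ∀ n → n ≤ suc (⌊ n /2⌋ + ⌊ n /2⌋)
n≤1+⌊n/2⌋+⌊n/2⌋ zero          = z≤n
n≤1+⌊n/2⌋+⌊n/2⌋ (suc zero)    = s≤s z≤n
n≤1+⌊n/2⌋+⌊n/2⌋ (suc (suc n)) rewrite +-suc ⌊ n /2⌋ ⌊ n /2⌋ = s≤s (s≤s (n≤1+⌊n/2⌋+⌊n/2⌋ n))

-- Chosen so that the labels 1 + zigzag at consecutive positions sum to q + 1 and q alternately.
zigzag : ℕ → ℕ → ℕ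
zigzag q m with parity m
... | 0ℙ = q ∸ suc ⌊ m /2⌋
... | 1ℙ = ⌊ m /2⌋

zigzag-even : ∀ q t → zigzag q (t + t) ≡ q ∸ suc t
zigzag-even q t rewrite parity-even t = cong (λ h → q ∸ suc h) (sym (n≡⌊n+n/2⌋ t))

zigzag-odd : ∀ q t → zigzag q (suc (t + t)) ≡ t
zigzag-odd q t rewrite parity-odd t = sym (n≡⌈n+n/2⌉ t)

zigzag-< : ∀ {q m} → m < q → zigzag q m < q
zigzag-< {q} {m} m<q with evenOdd m
... | even t rewrite zigzag-even q t = ∸-suc-< t (≤-<-trans z≤n m<q)
... | odd t  rewrite zigzag-odd q t  = ≤-<-trans (≤-trans (m≤m+n t t) (n≤1+n _)) m<q

zigzag⁻¹ : ℕ → ℕ → ℕ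
zigzag⁻¹ q v with v <? ⌊ q /2⌋
... | yes _ = suc (v + v)
... | no _  = (q ∸ suc v) + (q ∸ suc v)

zigzag⁻¹-< : ∀ {q v} → v < q → zigzag⁻¹ q v < q
zigzag⁻¹-< {q} {v} v<q with v <? ⌊ q /2⌋
... | yes v<h = begin-strict
  suc (v + v)    <⟨ ≤-reflexive (cong suc (sym (+-suc v v))) ⟩
  suc v + suc v  ≤⟨ +-mono-≤ v<h v<h ⟩
  ⌊ q /2⌋ + ⌊ q /2⌋ ≤⟨ ⌊n/2⌋+⌊n/2⌋≤n q ⟩
  q              ∎
  where open ≤-Reasoning
... | no v≮h = begin-strict
  w + w     ≤⟨ +-monoʳ-≤ w w≤v ⟩
  w + v     <⟨ +-monoʳ-< w ≤-refl ⟩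
  w + suc v ≡⟨ m∸n+n≡m v<q ⟩
  q         ∎
  where
  open ≤-Reasoning
  w : ℕ
  w = q ∸ suc v
  w≤v : w ≤ v
  w≤v = +-cancelʳ-≤ (suc v) w v (begin
    w + suc v                   ≡⟨ m∸n+n≡m v<q ⟩
    q                           ≤⟨ n≤1+⌊n/2⌋+⌊n/2⌋ q ⟩
    suc (⌊ q /2⌋ + ⌊ q /2⌋)     ≤⟨ s≤s (+-mono-≤ (≮⇒≥ v≮h) (≮⇒≥ v≮h)) ⟩
    suc (v + v)                 ≡⟨ sym (+-suc v v) ⟩
    v + suc v                   ∎)

zigzag-zigzag⁻¹ : ∀ {q v} → v < q → zigzag q (zigzag⁻¹ q v) ≡ v
zigzag-zigzag⁻¹ {q} {v} v<q with v <? ⌊ q /2⌋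
... | yes _ = zigzag-odd q v
... | no _  = trans (zigzag-even q (q ∸ suc v)) (∸-suc-involutive v<q)

zigzag⁻¹-zigzag : ∀ {q m} → m < q → zigzag⁻¹ q (zigzag q m) ≡ m
zigzag⁻¹-zigzag {q} {m} m<q with evenOdd m
... | odd t rewrite zigzag-odd q t with t <? ⌊ q /2⌋
...   | yes _   = refl
...   | no t≮h = ⊥-elim (t≮h (begin
  suc t                         ≡⟨ n≡⌊n+n/2⌋ (suc t) ⟩
  ⌊ suc t + suc t /2⌋           ≤⟨ ⌊n/2⌋-mono (≤-reflexive (cong suc (+-suc t t))) ⟩
  ⌊ suc (suc (t + t)) /2⌋       ≤⟨ ⌊n/2⌋-mono m<q ⟩
  ⌊ q /2⌋                       ∎))
  where open ≤-Reasoning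
zigzag⁻¹-zigzag {q} {m} m<q | even t rewrite zigzag-even q t with q ∸ suc t <? ⌊ q /2⌋
... | no _    = cong₂ _+_ t′≡t t′≡t
  where
  t′≡t : q ∸ suc (q ∸ suc t) ≡ t
  t′≡t = ∸-suc-involutive (≤-<-trans (m≤m+n t t) m<q)
... | yes w<h = ⊥-elim (<⇒≱ w<h (m+n≤o⇒m≤o∸n ⌊ q /2⌋ (begin
  ⌊ q /2⌋ + suc t               ≡⟨ cong (⌊ q /2⌋ +_) (cong suc (n≡⌊n+n/2⌋ t)) ⟩
  ⌊ q /2⌋ + ⌈ suc (t + t) /2⌉   ≤⟨ +-monoʳ-≤ ⌊ q /2⌋ (⌈n/2⌉-mono m<q) ⟩
  ⌊ q /2⌋ + ⌈ q /2⌉             ≡⟨ ⌊n/2⌋+⌈n/2⌉≡n q ⟩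
  q                             ∎)))
  where open ≤-Reasoning

zigzagLabel : ℕ → ℕ → ℕ
zigzagLabel q m = suc (zigzag q m)

zigzagLabel-pair-even : ∀ {q} t → suc (t + t) < q → zigzagLabel q (suc (t + t)) + zigzagLabel q (t + t) ≡ suc q
zigzagLabel-pair-even {q} t h rewrite zigzag-odd q t | zigzag-even q t =
  cong suc (trans (+-suc t (q ∸ suc t)) (m+[n∸m]≡n (≤-trans (s≤s (m≤m+n t t)) (<⇒≤ h))))

zigzagLabel-pair-odd : ∀ {q} t → suc (suc (t + t)) < q →
  zigzagLabel q (suc (suc (t + t))) + zigzagLabel q (suc (t + t)) ≡ q
zigzagLabel-pair-odd {q} t h = begin
  suc (zigzag q (suc (suc (t + t)))) + suc (zigzag q (suc (t + t)))
    ≡⟨ cong₂ (λ a b → suc a + suc b) zigzag-2t+2 (zigzag-odd q t) ⟩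
  suc (q ∸ suc (suc t)) + suc t
    ≡⟨ sym (+-suc (q ∸ suc (suc t)) (suc t)) ⟩
  (q ∸ suc (suc t)) + suc (suc t)
    ≡⟨ m∸n+n≡m (≤-trans (s≤s (s≤s (m≤m+n t t))) (<⇒≤ h)) ⟩
  q ∎
  where
  open ≡-Reasoning
  zigzag-2t+2 : zigzag q (suc (suc (t + t))) ≡ q ∸ suc (suc t)
  zigzag-2t+2 = trans (cong (zigzag q ∘ suc) (sym (+-suc t t))) (zigzag-even q (suc t))

zigzagLabel-pair : ∀ {q} m → suc m < q → zigzagLabel q (suc m) + zigzagLabel q m ≡ q + residue (parity (suc m))
zigzagLabel-pair {q} m m+1<q with evenOdd m
... | even t = trans (zigzagLabel-pair-even t m+1<q) (trans (+-comm 1 q) (cong (λ π → q + residue π) (sym (parity-odd t))))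
... | odd t  = trans (zigzagLabel-pair-odd t m+1<q) (trans (sym (+-identityʳ q)) (cong (λ π → q + residue π) (sym (parity-even t))))

doubledLabel : ℕ → ℕ → ℕ
doubledLabel q m = zigzagLabel q m + zigzagLabel q m

-- The amount by which twice the label of an even position m = q - 1 - s exceeds m + 1.
penalty : Parity → ℕ → ℕ
penalty 0ℙ s = suc (s + s)
penalty 1ℙ s = 0

doubledLabel-≡ : ∀ {q m} s → m + suc s ≡ q → doubledLabel q m ≡ suc m + penalty (parity m) s
doubledLabel-≡ {q} {m} s m+1+s≡q with evenOdd m
... | odd t rewrite zigzag-odd q t | parity-odd t =
  trans (cong suc (+-suc t t)) (sym (+-identityʳ _))
... | even t rewrite zigzag-even q t | parity-even t = begin
  suc (q ∸ suc t) + suc (q ∸ suc t) ≡⟨ cong (λ x → suc x + suc x) q∸1+t≡t+s ⟩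
  suc (t + s) + suc (t + s)         ≡⟨ double-sum t s ⟩
  suc (t + t) + suc (s + s)         ∎
  where
  open ≡-Reasoning
  regroup : ∀ t s → t + t + suc s ≡ suc t + (t + s)
  regroup = solve-∀
  q∸1+t≡t+s : q ∸ suc t ≡ t + s
  q∸1+t≡t+s = begin
    q ∸ suc t                 ≡⟨ cong (_∸ suc t) (sym m+1+s≡q) ⟩
    t + t + suc s ∸ suc t     ≡⟨ cong (_∸ suc t) (regroup t s) ⟩
    suc t + (t + s) ∸ suc t   ≡⟨ m+n∸m≡n (suc t) (t + s) ⟩
    t + s                     ∎
  double-sum : ∀ t s → suc (t + s) + suc (t + s) ≡ suc (t + t) + suc (s + s)
  double-sum = solve-∀

-- Deciding the local antimagic chromatic number

module _ {q : ℕ} {f g : ℕ → ℕ}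
  (f-< : ∀ {x} → x < q → f x < q) (g-< : ∀ {x} → x < q → g x < q)
  (g∘f : ∀ {x} → x < q → g (f x) ≡ x) (f∘g : ∀ {x} → x < q → f (g x) ≡ x) where

  private
    restrictF : Fin q → Fin q
    restrictF i = fromℕ< (f-< (toℕ<n i))

    restrictG : Fin q → Fin q
    restrictG i = fromℕ< (g-< (toℕ<n i))

  restrict-⤖ : Fin q ⤖ Fin q
  restrict-⤖ = mk⤖ {to = restrictF} (injective , surjective)
    where
    injective : ∀ {i j} → restrictF i ≡ restrictF j → i ≡ j
    injective {i} {j} eq = toℕ-injective (begin
      toℕ i                    ≡⟨ g∘f (toℕ<n i) ⟨
      g (f (toℕ i))            ≡⟨ cong g (toℕ-fromℕ< _) ⟨
      g (toℕ (restrictF i))    ≡⟨ cong (g ∘ toℕ) eq ⟩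
      g (toℕ (restrictF j))    ≡⟨ cong g (toℕ-fromℕ< _) ⟩
      g (f (toℕ j))            ≡⟨ g∘f (toℕ<n j) ⟩
      toℕ j                    ∎)
      where open ≡-Reasoning
    surjective : ∀ j → ∃ λ i → ∀ {z} → z ≡ i → restrictF z ≡ j
    surjective j = restrictG j , λ { refl → toℕ-injective
      (trans (toℕ-fromℕ< _) (trans (cong f (toℕ-fromℕ< _)) (f∘g (toℕ<n j)))) }

  toℕ-restrict-⤖ : ∀ i → toℕ (Bijection.to restrict-⤖ i) ≡ f (toℕ i)
  toℕ-restrict-⤖ i = toℕ-fromℕ< _

∃-function? : ∀ {n m} {P : (Fin n → Fin m) → Set} → (∀ {f g} → f ≗ g → P f → P g) →
  (∀ f → Dec (P f)) → Dec (∃ P)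
∃-function? {zero} resp P? = map′ (λ p → _ , p) (λ (f , p) → resp (λ ()) p) (P? (λ ()))
∃-function? {suc n} {m} {P} resp P? = map′
  (λ (b , f , p) → b Vector.∷ f , p)
  (λ (f , p) → f zero , f ∘ suc , resp (λ { zero → refl ; (suc i) → refl }) p)
  (any? λ b → ∃-function? (λ f≗g → resp (λ { zero → refl ; (suc i) → f≗g i })) (λ f → P? (b Vector.∷ f)))

incidentContribution-cong : ∀ G (σ τ : EdgeLabeling G) x e → label G σ e ≡ label G τ e →
  incidentContribution G σ x e ≡ incidentContribution G τ x e
incidentContribution-cong G σ τ x e eq with proj₁ (edgeAt G e) ≟ x | proj₂ (edgeAt G e) ≟ x
... | yes _ | _     = eq
... | no _  | yes _ = eq
... | no _  | no _  = refl

vertexSum-cong : ∀ G (σ τ : EdgeLabeling G) → Bijection.to σ ≗ Bijection.to τ → vertexSum G σ ≗ vertexSum G τ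
vertexSum-cong G σ τ eq x =
  cong sum (map-cong (λ e → incidentContribution-cong G σ τ x e (cong (suc ∘ toℕ) (eq e))) (allFin (numEdges G)))

Attains : (G : Graph) → ℕ → EdgeLabeling G → Set
Attains G k σ = IsLocalAntimagic G σ × numColors G σ ≡ k

numColors-cong : ∀ G (σ τ : EdgeLabeling G) → Bijection.to σ ≗ Bijection.to τ → numColors G σ ≡ numColors G τ
numColors-cong G σ τ eq = cong (length ∘ deduplicate _≟_) (map-cong (vertexSum-cong G σ τ eq) (upTo (nV G)))

Attains-cong : ∀ G {k} (σ τ : EdgeLabeling G) → Bijection.to σ ≗ Bijection.to τ → Attains G k σ → Attains G k τ
Attains-cong G σ τ eq (antimagic , colours) =
  (λ e sums≡ → antimagic e (trans (sums-cong _) (trans sums≡ (sym (sums-cong _))))) ,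
  trans (sym (numColors-cong G σ τ eq)) colours
  where
  sums-cong : vertexSum G σ ≗ vertexSum G τ
  sums-cong = vertexSum-cong G σ τ eq

Attains? : ∀ G k σ → Dec (Attains G k σ)
Attains? G k σ =
  all? (λ e → ¬? (vertexSum G σ (proj₁ (edgeAt G e)) ≟ vertexSum G σ (proj₂ (edgeAt G e))))
  ×-dec (numColors G σ ≟ k)

Inverses : ∀ {n} → (Fin n → Fin n) → (Fin n → Fin n) → Set
Inverses f g = (∀ i → g (f i) ≡ i) × (∀ j → f (g j) ≡ j)

Inverses? : ∀ {n} (f g : Fin n → Fin n) → Dec (Inverses f g)
Inverses? f g = all? (λ i → g (f i) Fin.≟ i) ×-dec all? (λ j → f (g j) Fin.≟ j)

Inverses⇒⤖ : ∀ {n} {f g : Fin n → Fin n} → Inverses f g → Fin n ⤖ Fin n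
Inverses⇒⤖ {f = f} {g} (g∘f , f∘g) =
  mk⤖ {to = f} ((λ {i} {j} eq → trans (sym (g∘f i)) (trans (cong g eq) (g∘f j))) , λ j → g j , λ { refl → f∘g j })

Attained : Graph → ℕ → Set
Attained G k = Σ (EdgeLabeling G) (Attains G k)

-- Decided by enumerating all pairs of mutually inverse maps on the edge indices.
Attained? : ∀ G k → Dec (Attained G k)
Attained? G k = map′ fromPair toPair (∃-function? resp-function (λ f → ∃-function? resp-inverse (GoodPair? f)))
  where
  GoodPair : (f g : Fin (numEdges G) → Fin (numEdges G)) → Set
  GoodPair f g = Σ (Inverses f g) λ inv → Attains G k (Inverses⇒⤖ inv)

  GoodPair? : ∀ f g → Dec (GoodPair f g)
  GoodPair? f g with Inverses? f g
  ... | no ¬inv = no (¬inv ∘ proj₁)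
  ... | yes inv with Attains? G k (Inverses⇒⤖ inv)
  ...   | yes good = yes (inv , good)
  ...   | no ¬good = no λ (inv′ , good) → ¬good (Attains-cong G (Inverses⇒⤖ inv′) (Inverses⇒⤖ inv) (λ _ → refl) good)

  resp-inverse : ∀ {f g g′} → g ≗ g′ → GoodPair f g → GoodPair f g′
  resp-inverse {f} {g} {g′} g≗g′ (inv , good) = inv′ , Attains-cong G (Inverses⇒⤖ inv) (Inverses⇒⤖ inv′) (λ _ → refl) good
    where
    inv′ : Inverses f g′
    inv′ = (λ i → trans (sym (g≗g′ (f i))) (proj₁ inv i)) , (λ j → trans (cong f (sym (g≗g′ j))) (proj₂ inv j))

  resp-function : ∀ {f f′} → f ≗ f′ → ∃ (GoodPair f) → ∃ (GoodPair f′)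
  resp-function {f} {f′} f≗f′ (g , inv , good) = g , inv′ , Attains-cong G (Inverses⇒⤖ inv) (Inverses⇒⤖ inv′) f≗f′ good
    where
    inv′ : Inverses f′ g
    inv′ = (λ i → trans (cong g (sym (f≗f′ i))) (proj₁ inv i)) , (λ j → trans (sym (f≗f′ (g j))) (proj₂ inv j))

  fromPair : ∃ (λ f → ∃ (GoodPair f)) → Attained G k
  fromPair (f , g , inv , good) = Inverses⇒⤖ inv , good

  toPair : Attained G k → ∃ (λ f → ∃ (GoodPair f))
  toPair (σ , good) = Bijection.to σ , from , inv , Attains-cong G σ (Inverses⇒⤖ inv) (λ _ → refl) good
    where
    from : Fin (numEdges G) → Fin (numEdges G)
    from j = proj₁ (Bijection.surjective σ j)
    to∘from : ∀ j → Bijection.to σ (from j) ≡ j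
    to∘from j = proj₂ (Bijection.surjective σ j) refl
    from∘to : ∀ i → from (Bijection.to σ i) ≡ i
    from∘to i = Bijection.injective σ (to∘from (Bijection.to σ i))
    inv : Inverses (Bijection.to σ) from
    inv = from∘to , to∘from

IsChiLa-from-bounds : ∀ G k → (∀ σ → IsLocalAntimagic G σ → k ≤ numColors G σ) →
  (Σ (EdgeLabeling G) λ σ → IsLocalAntimagic G σ × numColors G σ ≤ suc k) → IsChiLa G k ⊎ IsChiLa G (suc k)
IsChiLa-from-bounds G k atLeast (σ , antimagic , atMost) with Attained? G k
... | yes attained  = inj₁ (attained , atLeast)
... | no ¬attained = inj₂ ((σ , antimagic , ≤-antisym atMost (above σ antimagic)) , above)
  where
  above : ∀ τ → IsLocalAntimagic G τ → suc k ≤ numColors G τ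
  above τ antimagicτ = ≤∧≢⇒< (atLeast τ antimagicτ) (λ k≡ → ¬attained (τ , antimagicτ , sym k≡))

numColors-≥ : ∀ G σ {vals : List ℕ} → Unique vals →
  (∀ {z} → z ∈ vals → ∃ λ x → x < nV G × vertexSum G σ x ≡ z) → length vals ≤ numColors G σ
numColors-≥ G σ unique attained = Unique-length-≤ unique λ z∈ →
  let (x , x<n , sum≡z) = attained z∈ in
  ∈-deduplicate⁺ _≟_ (subst (_∈ _) sum≡z (∈-map⁺ (vertexSum G σ) (∈-upTo⁺ x<n)))

numColors-≤ : ∀ G σ (vals : List ℕ) → (∀ {x} → x < nV G → vertexSum G σ x ∈ vals) → numColors G σ ≤ length vals
numColors-≤ G σ vals covered = Unique-length-≤ (deduplicate-! _≟_ _) λ z∈ →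
  let (x , x∈ , z≡) = ∈-map⁻ (vertexSum G σ) (∈-deduplicate⁻ _≟_ _ z∈) in
  subst (_∈ vals) (sym z≡) (covered (∈-upTo⁻ x∈))

module _ {n : ℕ} (σ : Fin n ⤖ Fin n) where

  labelAt : ℕ → ℕ
  labelAt p with p <? n
  ... | yes p<n = suc (toℕ (Bijection.to σ (fromℕ< p<n)))
  ... | no _    = 0

  labelAt-< : ∀ {p} (p<n : p < n) → labelAt p ≡ suc (toℕ (Bijection.to σ (fromℕ< p<n)))
  labelAt-< {p} p<n with p <? n
  ... | yes p<n′ = cong (λ h → suc (toℕ (Bijection.to σ (fromℕ< h)))) (<-irrelevant p<n′ p<n)
  ... | no p≮n   = ⊥-elim (p≮n p<n)

  labelAt-toℕ : ∀ e → labelAt (toℕ e) ≡ suc (toℕ (Bijection.to σ e))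
  labelAt-toℕ e = trans (labelAt-< (toℕ<n e)) (cong (λ i → suc (toℕ (Bijection.to σ i))) (fromℕ<-toℕ e (toℕ<n e)))

  labelAt-positive : ∀ {p} → p < n → 0 < labelAt p
  labelAt-positive p<n = subst (0 <_) (sym (labelAt-< p<n)) z<s

  labelAt-≤ : ∀ {p} → p < n → labelAt p ≤ n
  labelAt-≤ p<n = subst (_≤ n) (sym (labelAt-< p<n)) (toℕ<n _)

  labelAt-injective : ∀ {p p′} → p < n → p′ < n → labelAt p ≡ labelAt p′ → p ≡ p′
  labelAt-injective {p} {p′} p<n p′<n eq = begin
    p                     ≡⟨ toℕ-fromℕ< p<n ⟨
    toℕ (fromℕ< p<n)      ≡⟨ cong toℕ (Bijection.injective σ (toℕ-injective (suc-injective to-eq))) ⟩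
    toℕ (fromℕ< p′<n)     ≡⟨ toℕ-fromℕ< p′<n ⟩
    p′                    ∎
    where
    open ≡-Reasoning
    to-eq : suc (toℕ (Bijection.to σ (fromℕ< p<n))) ≡ suc (toℕ (Bijection.to σ (fromℕ< p′<n)))
    to-eq = trans (sym (labelAt-< p<n)) (trans eq (labelAt-< p′<n))

  labelAt-surjective : ∀ {l} → l < n → ∃ λ p → p < n × labelAt p ≡ suc l
  labelAt-surjective {l} l<n = toℕ e , toℕ<n e , trans (labelAt-toℕ e) (cong suc (trans (cong toℕ to-e) (toℕ-fromℕ< l<n)))
    where
    e : Fin n
    e = proj₁ (Bijection.surjective σ (fromℕ< l<n))
    to-e : Bijection.to σ e ≡ fromℕ< l<n
    to-e = proj₂ (Bijection.surjective σ (fromℕ< l<n)) refl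

range : ℕ → ℕ → List ℕ
range a zero    = []
range a (suc n) = a ∷ range (suc a) n

rangeSum : ℕ → ℕ → (ℕ → ℕ) → ℕ
rangeSum a zero    g = 0
rangeSum a (suc n) g = g a + rangeSum (suc a) n g

<-+-suc : ∀ {p} a n → p < suc a + n → p < a + suc n
<-+-suc {p} a n = subst (p <_) (sym (+-suc a n))

a<a+1+n : ∀ a n → a < a + suc n
a<a+1+n a n = <-+-suc a n (s≤s (m≤m+n a n))

range-++ : ∀ a m n → range a (m + n) ≡ range a m ++ range (a + m) n
range-++ a zero    n = cong (λ b → range b n) (sym (+-identityʳ a))
range-++ a (suc m) n = cong (a ∷_) (trans (range-++ (suc a) m n) (cong (λ b → range (suc a) m ++ range b n) (sym (+-suc a m))))

All-range : ∀ {P : ℕ → Set} a n → (∀ {p} → a ≤ p → p < a + n → P p) → All P (range a n)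
All-range a zero    h = []
All-range a (suc n) h = h ≤-refl (a<a+1+n a n) ∷ All-range (suc a) n (λ a<p p< → h (<⇒≤ a<p) (<-+-suc a n p<))

rangeSum-++ : ∀ a m n g → rangeSum a (m + n) g ≡ rangeSum a m g + rangeSum (a + m) n g
rangeSum-++ a zero    n g = cong (λ b → rangeSum b n g) (sym (+-identityʳ a))
rangeSum-++ a (suc m) n g = begin
  g a + rangeSum (suc a) (m + n) g                          ≡⟨ cong (g a +_) (rangeSum-++ (suc a) m n g) ⟩
  g a + (rangeSum (suc a) m g + rangeSum (suc a + m) n g)
    ≡⟨ cong (λ b → g a + (rangeSum (suc a) m g + rangeSum b n g)) (sym (+-suc a m)) ⟩
  g a + (rangeSum (suc a) m g + rangeSum (a + suc m) n g)   ≡⟨ sym (+-assoc (g a) _ _) ⟩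
  g a + rangeSum (suc a) m g + rangeSum (a + suc m) n g     ∎
  where open ≡-Reasoning

rangeSum-cong : ∀ a n {g h} → (∀ {p} → a ≤ p → p < a + n → g p ≡ h p) → rangeSum a n g ≡ rangeSum a n h
rangeSum-cong a zero    eq = refl
rangeSum-cong a (suc n) eq = cong₂ _+_ (eq ≤-refl (a<a+1+n a n)) (rangeSum-cong (suc a) n (λ a<p p< → eq (<⇒≤ a<p) (<-+-suc a n p<)))

rangeSum-zero : ∀ a n {g} → (∀ {p} → a ≤ p → p < a + n → g p ≡ 0) → rangeSum a n g ≡ 0
rangeSum-zero a zero    eq = refl
rangeSum-zero a (suc n) eq = cong₂ _+_ (eq ≤-refl (a<a+1+n a n)) (rangeSum-zero (suc a) n (λ a<p p< → eq (<⇒≤ a<p) (<-+-suc a n p<)))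

sum-tabulate : ∀ {n} a (h : ℕ → ℕ) → sum (tabulate {n = n} (λ i → h (a + toℕ i))) ≡ rangeSum a n h
sum-tabulate {zero}  a h = refl
sum-tabulate {suc n} a h = cong₂ _+_ (cong h (+-identityʳ a))
  (trans (cong sum (tabulate-cong {n = n} (λ i → cong h (+-suc a (toℕ i))))) (sum-tabulate {n} (suc a) h))

incidentLabel : ℕ × ℕ → ℕ → ℕ → ℕ
incidentLabel e l x with proj₁ e ≟ x | proj₂ e ≟ x
... | yes _ | _     = l
... | no _  | yes _ = l
... | no _  | no _  = 0

incidentLabel-fst : ∀ {u v x} l → u ≡ x → incidentLabel (u , v) l x ≡ l
incidentLabel-fst {u} {v} {x} l u≡x with u ≟ x | v ≟ x
... | yes _ | _ = refl
... | no u≢x | _ = ⊥-elim (u≢x u≡x)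

incidentLabel-snd : ∀ {u v x} l → v ≡ x → incidentLabel (u , v) l x ≡ l
incidentLabel-snd {u} {v} {x} l v≡x with u ≟ x | v ≟ x
... | yes _ | _      = refl
... | no _  | yes _  = refl
... | no _  | no v≢x = ⊥-elim (v≢x v≡x)

incidentLabel-neither : ∀ {u v x} l → u ≢ x → v ≢ x → incidentLabel (u , v) l x ≡ 0
incidentLabel-neither {u} {v} {x} l u≢x v≢x with u ≟ x | v ≟ x
... | yes u≡x | _       = ⊥-elim (u≢x u≡x)
... | no _    | yes v≡x = ⊥-elim (v≢x v≡x)
... | no _    | no _    = refl

incidentContribution-≡ : ∀ G σ x e → incidentContribution G σ x e ≡ incidentLabel (edgeAt G e) (label G σ e) x
incidentContribution-≡ G σ x e with proj₁ (edgeAt G e) ≟ x | proj₂ (edgeAt G e) ≟ x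
... | yes _ | _     = refl
... | no _  | yes _ = refl
... | no _  | no _  = refl

vertexSum-by-index : ∀ G σ (edge : ℕ → ℕ × ℕ) (lab : ℕ → ℕ) →
  (∀ e → edgeAt G e ≡ edge (toℕ e)) → (∀ e → label G σ e ≡ lab (toℕ e)) →
  ∀ x → vertexSum G σ x ≡ rangeSum 0 (numEdges G) (λ p → incidentLabel (edge p) (lab p) x)
vertexSum-by-index G σ edge lab edge≡ label≡ x = begin
  sum (map (incidentContribution G σ x) (allFin (numEdges G)))  ≡⟨ cong sum (map-tabulate (λ e → e) (incidentContribution G σ x)) ⟩
  sum (tabulate (incidentContribution G σ x))                   ≡⟨ cong sum (tabulate-cong by-index) ⟩
  sum (tabulate {n = numEdges G} (h ∘ toℕ))                     ≡⟨ sum-tabulate {numEdges G} 0 h ⟩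
  rangeSum 0 (numEdges G) h                                     ∎
  where
  open ≡-Reasoning
  h : ℕ → ℕ
  h p = incidentLabel (edge p) (lab p) x
  by-index : ∀ e → incidentContribution G σ x e ≡ h (toℕ e)
  by-index e = trans (incidentContribution-≡ G σ x e) (cong₂ (λ u l → incidentLabel u l x) (edge≡ e) (label≡ e))

-- Spiders

-- Edge p of a spider joins vertex p + 1 to its parent: the core 0 if p is the first edge of its
-- leg, and vertex p otherwise.
parentIn : ℕ → ℕ → ℕ
parentIn off p with p ≟ off
... | yes _ = 0
... | no _  = p

parentFrom : ℕ → List ℕ → ℕ → ℕ
parentFrom off []       p = p
parentFrom off (y ∷ ys) p with p <? off + y
... | yes _ = parentIn off p
... | no _  = parentFrom (off + y) ys p

parentFrom-inside : ∀ off y ys {p} → p < off + y → parentFrom off (y ∷ ys) p ≡ parentIn off p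
parentFrom-inside off y ys {p} p< with p <? off + y
... | yes _ = refl
... | no p≮ = ⊥-elim (p≮ p<)

parentFrom-beyond : ∀ off y ys {p} → off + y ≤ p → parentFrom off (y ∷ ys) p ≡ parentFrom (off + y) ys p
parentFrom-beyond off y ys {p} ≤p with p <? off + y
... | yes p< = ⊥-elim (<⇒≱ p< ≤p)
... | no _   = refl

parentIn-start : ∀ off → parentIn off off ≡ 0
parentIn-start off with off ≟ off
... | yes _    = refl
... | no off≢ = ⊥-elim (off≢ refl)

parentIn-inner : ∀ {off p} → p ≢ off → parentIn off p ≡ p
parentIn-inner {off} {p} p≢off with p ≟ off
... | yes p≡off = ⊥-elim (p≢off p≡off)
... | no _      = refl

parentFrom-start : ∀ off k ys → parentFrom off (suc k ∷ ys) off ≡ 0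
parentFrom-start off k ys = trans (parentFrom-inside off (suc k) ys (a<a+1+n off k)) (parentIn-start off)

parentFrom-0-or-self : ∀ off ys p → parentFrom off ys p ≡ 0 ⊎ parentFrom off ys p ≡ p
parentFrom-0-or-self off []       p = inj₂ refl
parentFrom-0-or-self off (y ∷ ys) p with p <? off + y
... | no _  = parentFrom-0-or-self (off + y) ys p
... | yes _ with p ≟ off
...   | yes _ = inj₁ refl
...   | no _  = inj₂ refl

parentFrom-next : ∀ off y {ys} → PositiveLegs ys → off + y < off + sum (y ∷ ys) → parentFrom off (y ∷ ys) (off + y) ≡ 0
parentFrom-next off y {[]}         _ end< = ⊥-elim (<⇒≢ end< (cong (off +_) (sym (+-identityʳ y))))
parentFrom-next off y {zero ∷ _}   (() ∷ _) _
parentFrom-next off y {suc k ∷ ys} _ _ = trans (parentFrom-beyond off y (suc k ∷ ys) ≤-refl) (parentFrom-start (off + y) k ys)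

spiderEdge : ℕ → List ℕ → ℕ → ℕ × ℕ
spiderEdge off ys p = parentFrom off ys p , suc p

map-cong-range : ∀ {A : Set} {f g : ℕ → A} a n → (∀ {p} → a ≤ p → p < a + n → f p ≡ g p) →
  map f (range a n) ≡ map g (range a n)
map-cong-range a n eq = map-cong-local (All-range a n eq)

pathEdges-range : ∀ a k → pathEdges a (suc a) k ≡ map (λ p → p , suc p) (range a k)
pathEdges-range a zero    = refl
pathEdges-range a (suc k) = cong ((a , suc a) ∷_) (pathEdges-range (suc a) k)

legEdges-range : ∀ off y ys → pathEdges 0 (suc off) y ≡ map (spiderEdge off (y ∷ ys)) (range off y)
legEdges-range off zero    ys = refl
legEdges-range off (suc k) ys = cong₂ _∷_
  (cong (_, suc off) (sym (parentFrom-start off k ys)))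
  (trans (pathEdges-range (suc off) k) (map-cong-range (suc off) k λ off<p p< →
    cong (_, suc _) (sym (trans (parentFrom-inside off (suc k) ys (<-+-suc off k p<)) (parentIn-inner (>⇒≢ off<p))))))

spiderEdges-range : ∀ off ys → spiderEdges off ys ≡ map (spiderEdge off ys) (range off (sum ys))
spiderEdges-range off []       = refl
spiderEdges-range off (y ∷ ys) = begin
  pathEdges 0 (suc off) y ++ spiderEdges (off + y) ys
    ≡⟨ cong₂ _++_ (legEdges-range off y ys) (trans (spiderEdges-range (off + y) ys) (map-cong-range (off + y) (sum ys) λ ≤p _ →
         cong (_, suc _) (sym (parentFrom-beyond off y ys ≤p)))) ⟩
  map (spiderEdge off (y ∷ ys)) (range off y) ++ map (spiderEdge off (y ∷ ys)) (range (off + y) (sum ys))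
    ≡⟨ sym (map-++ (spiderEdge off (y ∷ ys)) (range off y) _) ⟩
  map (spiderEdge off (y ∷ ys)) (range off y ++ range (off + y) (sum ys))
    ≡⟨ cong (map (spiderEdge off (y ∷ ys))) (sym (range-++ off y (sum ys))) ⟩
  map (spiderEdge off (y ∷ ys)) (range off (y + sum ys)) ∎
  where open ≡-Reasoning

length-range : ∀ a n → length (range a n) ≡ n
length-range a zero    = refl
length-range a (suc n) = cong suc (length-range (suc a) n)

lookup-map-range : ∀ {A : Set} (F : ℕ → A) a n (e : Fin (length (map F (range a n)))) →
  lookup (map F (range a n)) e ≡ F (a + toℕ e)
lookup-map-range F a (suc n) zero    = cong F (sym (+-identityʳ a))
lookup-map-range F a (suc n) (suc e) = trans (lookup-map-range F (suc a) n e) (cong F (sym (+-suc a (toℕ e))))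

lookup-≡-map-range : ∀ {A : Set} {E : List A} (F : ℕ → A) a n → E ≡ map F (range a n) →
  ∀ e → lookup E e ≡ F (a + toℕ e)
lookup-≡-map-range F a n refl = lookup-map-range F a n

legsFrom : ℕ → List ℕ → List (ℕ × ℕ)
legsFrom off []       = []
legsFrom off (y ∷ ys) = (off , y) ∷ legsFrom (off + y) ys

legStarts : ℕ → List ℕ → List ℕ
legStarts off ys = map proj₁ (legsFrom off ys)

legEnds : ℕ → List ℕ → List ℕ
legEnds off ys = map (λ (o , y) → o + y) (legsFrom off ys)

length-legsFrom : ∀ off ys → length (legsFrom off ys) ≡ length ys
length-legsFrom off []       = refl
length-legsFrom off (y ∷ ys) = cong suc (length-legsFrom (off + y) ys)

sum-map-proj₂-legsFrom : ∀ off ys → sum (map proj₂ (legsFrom off ys)) ≡ sum ys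
sum-map-proj₂-legsFrom off []       = refl
sum-map-proj₂-legsFrom off (y ∷ ys) = cong (y +_) (sum-map-proj₂-legsFrom (off + y) ys)

legsFrom-bounds : ∀ off ys {o y} → (o , y) ∈ legsFrom off ys → off ≤ o × o + y ≤ off + sum ys
legsFrom-bounds off (y ∷ ys) (here refl) = ≤-refl , +-monoʳ-≤ off (m≤m+n y (sum ys))
legsFrom-bounds off (y ∷ ys) (there m) with legsFrom-bounds (off + y) ys m
... | off+y≤o , ≤sum = ≤-trans (m≤m+n off y) off+y≤o , ≤-trans ≤sum (≤-reflexive (+-assoc off y (sum ys)))

legsFrom-positive : ∀ off {ys o y} → PositiveLegs ys → (o , y) ∈ legsFrom off ys → 1 ≤ y
legsFrom-positive off (1≤y ∷ _)   (here refl) = 1≤y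
legsFrom-positive off (_ ∷ 1≤ys) (there m)   = legsFrom-positive _ 1≤ys m

length≤sum : ∀ {ys} → PositiveLegs ys → length ys ≤ sum ys
length≤sum []           = z≤n
length≤sum (1≤y ∷ 1≤ys) = +-mono-≤ 1≤y (length≤sum 1≤ys)

empty-range : ∀ {off p} → off ≤ p → p < off + sum [] → ∀ {A : Set} → A
empty-range {off} off≤p p< = ⊥-elim (<⇒≱ p< (≤-trans (≤-reflexive (+-identityʳ off)) off≤p))

<-+-assoc : ∀ {p} off y ys → p < off + sum (y ∷ ys) → p < off + y + sum ys
<-+-assoc {p} off y ys = subst (p <_) (sym (+-assoc off y (sum ys)))

parentFrom≡0⇒∈legStarts : ∀ off ys {p} → off ≤ p → p < off + sum ys → parentFrom off ys p ≡ 0 → p ∈ legStarts off ys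
parentFrom≡0⇒∈legStarts off []       off≤p p< _ = empty-range off≤p p<
parentFrom≡0⇒∈legStarts off (y ∷ ys) {p} off≤p p< parent≡0 with p <? off + y
... | no p≮ = there (parentFrom≡0⇒∈legStarts (off + y) ys (≮⇒≥ p≮) (<-+-assoc off y ys p<) parent≡0)
... | yes _ with p ≟ off
...   | yes p≡off = here p≡off
...   | no p≢off  = ⊥-elim (<⇒≢ (≤-<-trans z≤n (≤∧≢⇒< off≤p (p≢off ∘ sym))) (sym parent≡0))

∈legStarts⇒∈legEnds : ∀ off ys {p} → p ∈ legStarts off ys → p ≢ off → p ∈ legEnds off ys
∈legStarts⇒∈legEnds off (y ∷ ys) (here p≡off) p≢off = ⊥-elim (p≢off p≡off)
∈legStarts⇒∈legEnds off (y ∷ ys) {p} (there m) _ with p ≟ off + y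
... | yes p≡ = here p≡
... | no p≢  = there (∈legStarts⇒∈legEnds (off + y) ys m p≢)

off+sum∈legEnds : ∀ off y ys → off + sum (y ∷ ys) ∈ legEnds off (y ∷ ys)
off+sum∈legEnds off y []        = here (cong (off +_) (+-identityʳ y))
off+sum∈legEnds off y (y′ ∷ ys) =
  there (subst (_∈ legEnds (off + y) (y′ ∷ ys)) (+-assoc off y (sum (y′ ∷ ys))) (off+sum∈legEnds (off + y) y′ ys))

sum∈legEnds : ∀ ys → 0 < sum ys → sum ys ∈ legEnds 0 ys
sum∈legEnds (y ∷ ys) _ = off+sum∈legEnds 0 y ys

∈legEnds-bounds : ∀ off {ys x} → PositiveLegs ys → x ∈ legEnds off ys → off < x × x ≤ off + sum ys
∈legEnds-bounds off {zero ∷ _} (() ∷ _) _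
∈legEnds-bounds off {suc k ∷ ys} (_ ∷ _) (here refl) = a<a+1+n off k , +-monoʳ-≤ off (m≤m+n (suc k) (sum ys))
∈legEnds-bounds off {suc k ∷ ys} (_ ∷ 1≤ys) (there m) with ∈legEnds-bounds (off + suc k) 1≤ys m
... | off′<x , x≤ = <-trans (a<a+1+n off k) off′<x , ≤-trans x≤ (≤-reflexive (+-assoc off (suc k) (sum ys)))

∈legEnds-leaf : ∀ off {ys x} → PositiveLegs ys → x ∈ legEnds off ys → x ≡ off + sum ys ⊎ parentFrom off ys x ≡ 0
∈legEnds-leaf off {zero ∷ _} (() ∷ _) _
∈legEnds-leaf off {suc k ∷ zero ∷ _} (_ ∷ () ∷ _) _
∈legEnds-leaf off {suc k ∷ []} _ (here refl) = inj₁ (cong (off +_) (sym (+-identityʳ (suc k))))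
∈legEnds-leaf off {suc k ∷ suc k′ ∷ ys} _ (here refl) =
  inj₂ (trans (parentFrom-beyond off (suc k) _ ≤-refl) (parentFrom-start (off + suc k) k′ ys))
∈legEnds-leaf off {suc k ∷ ys} {x} (_ ∷ 1≤ys) (there m) with ∈legEnds-leaf (off + suc k) 1≤ys m
... | inj₁ x≡ = inj₁ (trans x≡ (+-assoc off (suc k) (sum ys)))
... | inj₂ parent≡0 = inj₂ (trans (parentFrom-beyond off (suc k) ys (<⇒≤ (proj₁ (∈legEnds-bounds _ 1≤ys m)))) parent≡0)

Unique-legEnds : ∀ off {ys} → PositiveLegs ys → Unique (legEnds off ys)
Unique-legEnds off []            = []
Unique-legEnds off (_ ∷ 1≤ys) =
  All.tabulate (λ m → <⇒≢ (proj₁ (∈legEnds-bounds _ 1≤ys m))) ∷ Unique-legEnds _ 1≤ys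

parentFrom≢0⇒length<sum : ∀ off {ys p} → PositiveLegs ys → off ≤ p → p < off + sum ys → parentFrom off ys p ≢ 0 →
  suc (length ys) ≤ sum ys
parentFrom≢0⇒length<sum off {[]} _ off≤p p< _ = empty-range off≤p p<
parentFrom≢0⇒length<sum off {y ∷ ys} {p} (1≤y ∷ 1≤ys) off≤p p< parent≢0 with p <? off + y
... | no p≮ = +-mono-≤ 1≤y (parentFrom≢0⇒length<sum (off + y) 1≤ys (≮⇒≥ p≮) (<-+-assoc off y ys p<) parent≢0)
... | yes p<off+y with p ≟ off
...   | yes _    = ⊥-elim (parent≢0 refl)
...   | no p≢off = +-mono-≤ 2≤y (length≤sum 1≤ys)
  where
  2≤y : 2 ≤ y
  2≤y = +-cancelˡ-≤ off 2 y (≤-trans (≤-reflexive (+-comm off 2)) (≤-trans (s≤s (≤∧≢⇒< off≤p (p≢off ∘ sym))) p<off+y))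

<⇒∃+suc : ∀ {a q} → a < q → ∃ λ r → q ≡ a + suc r
<⇒∃+suc {a} a<q with m≤n⇒∃[o]m+o≡n a<q
... | r , 1+a+r≡q = r , trans (sym 1+a+r≡q) (sym (+-suc a r))

coreSum : ∀ off {ys} (lab : ℕ → ℕ) → PositiveLegs ys →
  rangeSum off (sum ys) (λ p → incidentLabel (spiderEdge off ys p) (lab p) 0) ≡ sum (map lab (legStarts off ys))
coreSum off {[]} lab [] = refl
coreSum off {suc k ∷ ys} lab (_ ∷ 1≤ys) = begin
  rangeSum off (suc k + sum ys) g                                    ≡⟨ rangeSum-++ off (suc k) (sum ys) g ⟩
  g off + rangeSum (suc off) k g + rangeSum (off + suc k) (sum ys) g ≡⟨ cong₂ _+_ (cong₂ _+_ first-edge inner-edges) later-legs ⟩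
  lab off + 0 + sum (map lab (legStarts (off + suc k) ys))
    ≡⟨ cong (_+ sum (map lab (legStarts (off + suc k) ys))) (+-identityʳ (lab off)) ⟩
  lab off + sum (map lab (legStarts (off + suc k) ys))               ∎
  where
  open ≡-Reasoning
  g : ℕ → ℕ
  g p = incidentLabel (spiderEdge off (suc k ∷ ys) p) (lab p) 0
  first-edge : g off ≡ lab off
  first-edge = incidentLabel-fst (lab off) (parentFrom-start off k ys)
  inner-edges : rangeSum (suc off) k g ≡ 0
  inner-edges = rangeSum-zero (suc off) k λ off<p p< → incidentLabel-neither (lab _)
    (λ parent≡0 → <⇒≢ (≤-<-trans z≤n off<p)
      (sym (trans (sym (parentIn-inner (>⇒≢ off<p))) (trans (sym (parentFrom-inside off (suc k) ys (<-+-suc off k p<))) parent≡0))))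
    (λ ())
  later-legs : rangeSum (off + suc k) (sum ys) g ≡ sum (map lab (legStarts (off + suc k) ys))
  later-legs = trans (rangeSum-cong (off + suc k) (sum ys) λ ≤p _ → cong (λ u → incidentLabel (u , _) (lab _) 0) (parentFrom-beyond off (suc k) ys ≤p))
                     (coreSum (off + suc k) lab 1≤ys)

module SpiderSums (ys : List ℕ) (1≤ys : PositiveLegs ys) where

  q : ℕ
  q = sum ys

  parent : ℕ → ℕ
  parent = parentFrom 0 ys

  incidence : (ℕ → ℕ) → ℕ → ℕ → ℕ
  incidence lab x p = incidentLabel (parent p , suc p) (lab p) x

  vertexSumBy : (ℕ → ℕ) → ℕ → ℕ
  vertexSumBy lab x = rangeSum 0 q (incidence lab x)

  numEdges-Spider : numEdges (Spider ys) ≡ q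
  numEdges-Spider = trans (cong length (spiderEdges-range 0 ys)) (trans (length-map _ (range 0 q)) (length-range 0 q))

  edgeAt-Spider : ∀ e → edgeAt (Spider ys) e ≡ (parent (toℕ e) , suc (toℕ e))
  edgeAt-Spider = lookup-≡-map-range (spiderEdge 0 ys) 0 q (spiderEdges-range 0 ys)

  vertexSum-Spider : ∀ σ (lab : ℕ → ℕ) → (∀ e → label (Spider ys) σ e ≡ lab (toℕ e)) →
    ∀ x → vertexSum (Spider ys) σ x ≡ vertexSumBy lab x
  vertexSum-Spider σ lab label≡ x = trans
    (vertexSum-by-index (Spider ys) σ (spiderEdge 0 ys) lab edgeAt-Spider label≡ x)
    (cong (λ n → rangeSum 0 n (incidence lab x)) numEdges-Spider)

  Internal : ℕ → Set
  Internal v = 0 < v × v < q × parent v ≡ v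

  Internal? : ∀ v → Dec (Internal v)
  Internal? v = (0 <? v) ×-dec (v <? q) ×-dec (parent v ≟ v)

  parent-≢ : ∀ {p x} → 0 < x → p ≢ x → parent p ≢ x
  parent-≢ {p} 0<x p≢x parent≡x with parentFrom-0-or-self 0 ys p
  ... | inj₁ parent≡0 = <⇒≢ 0<x (trans (sym parent≡0) parent≡x)
  ... | inj₂ parent≡p = p≢x (trans (sym parent≡p) parent≡x)

  vertexSumBy-core : ∀ lab → vertexSumBy lab 0 ≡ sum (map lab (legStarts 0 ys))
  vertexSumBy-core lab = coreSum 0 lab 1≤ys

  -- Only edges t and t + 1 can meet vertex t + 1.
  vertexSumBy-suc : ∀ lab {t r} → q ≡ t + suc r → vertexSumBy lab (suc t) ≡ lab t + rangeSum (suc t) r (incidence lab (suc t))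
  vertexSumBy-suc lab {t} {r} q≡ = begin
    rangeSum 0 q g                                    ≡⟨ cong (λ n → rangeSum 0 n g) q≡ ⟩
    rangeSum 0 (t + suc r) g                          ≡⟨ rangeSum-++ 0 t (suc r) g ⟩
    rangeSum 0 t g + (g t + rangeSum (suc t) r g)
      ≡⟨ cong₂ (λ a b → a + (b + rangeSum (suc t) r g)) below (incidentLabel-snd (lab t) refl) ⟩
    lab t + rangeSum (suc t) r g                      ∎
    where
    open ≡-Reasoning
    g : ℕ → ℕ
    g = incidence lab (suc t)
    below : rangeSum 0 t g ≡ 0
    below = rangeSum-zero 0 t λ _ p<t →
      incidentLabel-neither (lab _) (parent-≢ z<s (<⇒≢ (m<n⇒m<1+n p<t))) (<⇒≢ (s≤s p<t))

  beyond-suc : ∀ lab t r → rangeSum (suc (suc t)) r (incidence lab (suc t)) ≡ 0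
  beyond-suc lab t r = rangeSum-zero (suc (suc t)) r λ t+2≤p _ →
    incidentLabel-neither (lab _) (parent-≢ z<s (>⇒≢ t+2≤p)) (>⇒≢ (m≤n⇒m≤1+n t+2≤p))

  vertexSumBy-internal : ∀ lab t → Internal (suc t) → vertexSumBy lab (suc t) ≡ lab t + lab (suc t)
  vertexSumBy-internal lab t (_ , t+1<q , parent≡) with <⇒∃+suc t+1<q
  ... | r , q≡ = begin
    vertexSumBy lab (suc t)                                   ≡⟨ vertexSumBy-suc lab (trans q≡ (sym (+-suc t (suc r)))) ⟩
    lab t + (g (suc t) + rangeSum (suc (suc t)) r g)
      ≡⟨ cong (lab t +_) (cong₂ _+_ (incidentLabel-fst (lab (suc t)) parent≡) (beyond-suc lab t r)) ⟩
    lab t + (lab (suc t) + 0)                                 ≡⟨ cong (lab t +_) (+-identityʳ (lab (suc t))) ⟩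
    lab t + lab (suc t)                                       ∎
    where
    open ≡-Reasoning
    g : ℕ → ℕ
    g = incidence lab (suc t)

  vertexSumBy-leaf : ∀ lab t → suc t ≤ q → suc t ≡ q ⊎ parent (suc t) ≡ 0 → vertexSumBy lab (suc t) ≡ lab t
  vertexSumBy-leaf lab t _ (inj₁ t+1≡q) =
    trans (vertexSumBy-suc lab (trans (sym t+1≡q) (+-comm 1 t))) (+-identityʳ (lab t))
  vertexSumBy-leaf lab t t+1≤q (inj₂ parent≡0) with m≤n⇒m<n∨m≡n t+1≤q
  ... | inj₂ t+1≡q = vertexSumBy-leaf lab t t+1≤q (inj₁ t+1≡q)
  ... | inj₁ t+1<q with <⇒∃+suc t+1<q
  ...   | r , q≡ = begin
    vertexSumBy lab (suc t)                                   ≡⟨ vertexSumBy-suc lab (trans q≡ (sym (+-suc t (suc r)))) ⟩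
    lab t + (g (suc t) + rangeSum (suc (suc t)) r g)          ≡⟨ cong (lab t +_) (cong₂ _+_ edge-below-leaf (beyond-suc lab t r)) ⟩
    lab t + 0                                                 ≡⟨ +-identityʳ (lab t) ⟩
    lab t                                                     ∎
    where
    open ≡-Reasoning
    g : ℕ → ℕ
    g = incidence lab (suc t)
    edge-below-leaf : g (suc t) ≡ 0
    edge-below-leaf = incidentLabel-neither (lab (suc t)) (λ parent≡ → 0≢1+n (trans (sym parent≡0) parent≡)) 1+n≢n

  vertexSumBy-legEnd : ∀ lab {x} → x ∈ legEnds 0 ys → vertexSumBy lab x ≡ lab (pred x)
  vertexSumBy-legEnd lab {suc t} x∈ = vertexSumBy-leaf lab t (proj₂ (∈legEnds-bounds 0 1≤ys x∈)) (∈legEnds-leaf 0 1≤ys x∈)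
  vertexSumBy-legEnd lab {zero}  x∈ = ⊥-elim (<⇒≱ (proj₁ (∈legEnds-bounds 0 1≤ys x∈)) z≤n)

  ¬Internal⇒∈legEnds : ∀ {x} → 0 < x → x ≤ q → ¬ Internal x → x ∈ legEnds 0 ys
  ¬Internal⇒∈legEnds {x} 0<x x≤q ¬internal with m≤n⇒m<n∨m≡n x≤q
  ... | inj₂ refl = sum∈legEnds ys 0<x
  ... | inj₁ x<q with parentFrom-0-or-self 0 ys x
  ...   | inj₂ parent≡x = ⊥-elim (¬internal (0<x , x<q , parent≡x))
  ...   | inj₁ parent≡0 = ∈legStarts⇒∈legEnds 0 ys (parentFrom≡0⇒∈legStarts 0 ys z≤n x<q parent≡0) (>⇒≢ 0<x)

  Internal⇒length<q : ∀ {v} → Internal v → suc (length ys) ≤ q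
  Internal⇒length<q (0<v , v<q , parent≡v) =
    parentFrom≢0⇒length<sum 0 1≤ys z≤n v<q (λ parent≡0 → <⇒≢ 0<v (sym (trans (sym parent≡v) parent≡0)))

  ∈legStarts-< : ∀ {p} → p ∈ legStarts 0 ys → p < q
  ∈legStarts-< p∈ with ∈-map⁻ proj₁ p∈
  ... | (o , y) , leg∈ , refl = begin
    suc o   ≡⟨ +-comm 1 o ⟩
    o + 1   ≤⟨ +-monoʳ-≤ o (legsFrom-positive 0 1≤ys leg∈) ⟩
    o + y   ≤⟨ proj₂ (legsFrom-bounds 0 ys leg∈) ⟩
    q       ∎
    where open ≤-Reasoning

  parent-≤ : ∀ {p} → p < q → parent p ≤ q
  parent-≤ {p} p<q with parentFrom-0-or-self 0 ys p
  ... | inj₁ parent≡0 = subst (_≤ q) (sym parent≡0) z≤n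
  ... | inj₂ parent≡p = subst (_≤ q) (sym parent≡p) (<⇒≤ p<q)

  module _ (2≤d : 2 ≤ length ys) (lab : ℕ → ℕ) (lab-positive : ∀ {p} → p < q → 0 < lab p) where

    lab<vertexSumBy-core : ∀ {p} → p < q → parent p ≡ 0 → lab p < vertexSumBy lab 0
    lab<vertexSumBy-core {p} p<q parent≡0 = subst (lab p <_) (sym (vertexSumBy-core lab))
      (∈⇒<sum all-positive (∈-map⁺ lab (parentFrom≡0⇒∈legStarts 0 ys z≤n p<q parent≡0)) two-legs)
      where
      all-positive : All (0 <_) (map lab (legStarts 0 ys))
      all-positive = All.tabulate λ z∈ → let (o , o∈ , z≡) = ∈-map⁻ lab z∈ in
        subst (0 <_) (sym z≡) (lab-positive (∈legStarts-< o∈))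
      two-legs : 2 ≤ length (map lab (legStarts 0 ys))
      two-legs = subst (2 ≤_) (sym (trans (length-map lab (legStarts 0 ys)) (trans (length-map proj₁ (legsFrom 0 ys)) (length-legsFrom 0 ys)))) 2≤d

    lab<vertexSumBy-parent : ∀ {p} → p < q → lab p < vertexSumBy lab (parent p)
    lab<vertexSumBy-parent {p} p<q with parentFrom-0-or-self 0 ys p
    ... | inj₁ parent≡0 = subst (λ v → lab p < vertexSumBy lab v) (sym parent≡0) (lab<vertexSumBy-core p<q parent≡0)
    lab<vertexSumBy-parent {zero} p<q | inj₂ parent≡0 =
      subst (λ v → lab 0 < vertexSumBy lab v) (sym parent≡0) (lab<vertexSumBy-core p<q parent≡0)
    lab<vertexSumBy-parent {suc t} p<q | inj₂ parent≡p = begin-strict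
      lab (suc t)              <⟨ m<n+m (lab (suc t)) (lab-positive (≤-trans (n≤1+n _) p<q)) ⟩
      lab t + lab (suc t)      ≡⟨ vertexSumBy-internal lab t (z<s , p<q , parent≡p) ⟨
      vertexSumBy lab (suc t)  ≡⟨ cong (vertexSumBy lab) parent≡p ⟨
      vertexSumBy lab (parent (suc t)) ∎
      where open ≤-Reasoning

  length-legEnds : length (legEnds 0 ys) ≡ length ys
  length-legEnds = trans (length-map _ (legsFrom 0 ys)) (length-legsFrom 0 ys)

  pred-legEnd-< : ∀ {x} → x ∈ legEnds 0 ys → pred x < q
  pred-legEnd-< {suc t} x∈ = proj₂ (∈legEnds-bounds 0 1≤ys x∈)
  pred-legEnd-< {zero}  x∈ = ⊥-elim (<⇒≱ (proj₁ (∈legEnds-bounds 0 1≤ys x∈)) z≤n)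

  legEnd-injective : ∀ {a b} → a ∈ legEnds 0 ys → b ∈ legEnds 0 ys → pred a ≡ pred b → a ≡ b
  legEnd-injective {suc _} {suc _} _ _ eq = cong suc eq
  legEnd-injective {zero} a∈ _ _ = ⊥-elim (<⇒≱ (proj₁ (∈legEnds-bounds 0 1≤ys a∈)) z≤n)
  legEnd-injective {suc _} {zero} _ b∈ _ = ⊥-elim (<⇒≱ (proj₁ (∈legEnds-bounds 0 1≤ys b∈)) z≤n)

  numColors-Spider-≥ : 2 ≤ length ys → ∀ σ → suc (length ys) ≤ numColors (Spider ys) σ
  numColors-Spider-≥ 2≤d σ =
    subst (_≤ numColors G σ) (cong suc (trans (length-map _ (legEnds 0 ys)) length-legEnds)) (numColors-≥ G σ unique attained)
    where
    G : Graph
    G = Spider ys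
    lab : ℕ → ℕ
    lab = labelAt σ
    <n : ∀ {p} → p < q → p < numEdges G
    <n = subst (_ <_) (sym numEdges-Spider)
    lab-≤ : ∀ {p} → p < q → lab p ≤ q
    lab-≤ p<q = subst (lab _ ≤_) numEdges-Spider (labelAt-≤ σ (<n p<q))
    sums : ∀ x → vertexSum G σ x ≡ vertexSumBy lab x
    sums = vertexSum-Spider σ lab (λ e → sym (labelAt-toℕ σ e))
    0<q : 0 < q
    0<q = ≤-trans (s≤s z≤n) (≤-trans 2≤d (length≤sum 1≤ys))
    heaviest : ∃ λ p → p < q × lab p ≡ q
    heaviest with labelAt-surjective σ (<n (∸-suc-< 0 0<q))
    ... | p , p<n , lab≡ = p , subst (p <_) numEdges-Spider p<n , trans lab≡ (m+[n∸m]≡n 0<q)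
    p* : ℕ
    p* = proj₁ heaviest
    leafSum-≤ : ∀ {x} → x ∈ legEnds 0 ys → vertexSumBy lab x ≤ q
    leafSum-≤ x∈ = subst (_≤ q) (sym (vertexSumBy-legEnd lab x∈)) (lab-≤ (pred-legEnd-< x∈))
    heavy : q < vertexSumBy lab (parent p*)
    heavy = subst (_< vertexSumBy lab (parent p*)) (proj₂ (proj₂ heaviest))
      (lab<vertexSumBy-parent 2≤d lab (labelAt-positive σ ∘ <n) (proj₁ (proj₂ heaviest)))
    vals : List ℕ
    vals = vertexSumBy lab (parent p*) ∷ map (vertexSumBy lab) (legEnds 0 ys)
    unique : Unique vals
    unique = All.tabulate (λ z∈ eq → let (x , x∈ , z≡) = ∈-map⁻ (vertexSumBy lab) z∈ in
               <⇒≱ heavy (subst (_≤ q) (sym (trans eq z≡)) (leafSum-≤ x∈)))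
           ∷ Unique-map⁺ (vertexSumBy lab) (λ a∈ b∈ a≢b eq → a≢b (legEnd-injective a∈ b∈
               (labelAt-injective σ (<n (pred-legEnd-< a∈)) (<n (pred-legEnd-< b∈))
                 (trans (sym (vertexSumBy-legEnd lab a∈)) (trans eq (vertexSumBy-legEnd lab b∈))))))
               (All.tabulate (λ x∈ → x∈)) (Unique-legEnds 0 1≤ys)
    attained : ∀ {z} → z ∈ vals → ∃ λ x → x < nV G × vertexSum G σ x ≡ z
    attained (here refl) = parent p* , s≤s (parent-≤ (proj₁ (proj₂ heaviest))) , sums _
    attained (there z∈) = let (x , x∈ , z≡) = ∈-map⁻ (vertexSumBy lab) z∈ in
      x , s≤s (proj₂ (∈legEnds-bounds 0 1≤ys x∈)) , trans (sums x) (sym z≡)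

  -- τ-step says that τ runs backwards along every leg: consecutive edges of a leg get positions
  -- m + 1 and m, so every internal vertex sums to q or q + 1.
  module Scheme (2≤d : 2 ≤ length ys) (τ : ℕ → ℕ) (τ-< : ∀ {p} → p < q → τ p < q)
    (τ-involutive : ∀ {p} → p < q → τ (τ p) ≡ p) (τ-step : ∀ {p} → Internal (suc p) → τ p ≡ suc (τ (suc p))) where

    lab : ℕ → ℕ
    lab p = zigzagLabel q (τ p)

    private
      n : ℕ
      n = numEdges (Spider ys)
      <q : ∀ {p} → p < n → p < q
      <q = subst (_ <_) numEdges-Spider
      <n : ∀ {p} → p < q → p < n
      <n = subst (_ <_) (sym numEdges-Spider)
      f g : ℕ → ℕ
      f = zigzag q ∘ τ
      g = τ ∘ zigzag⁻¹ q
      f-< : ∀ {p} → p < n → f p < n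
      f-< p< = <n (zigzag-< (τ-< (<q p<)))
      g-< : ∀ {p} → p < n → g p < n
      g-< p< = <n (τ-< (zigzag⁻¹-< (<q p<)))
      g∘f : ∀ {p} → p < n → g (f p) ≡ p
      g∘f p< = trans (cong τ (zigzag⁻¹-zigzag (τ-< (<q p<)))) (τ-involutive (<q p<))
      f∘g : ∀ {p} → p < n → f (g p) ≡ p
      f∘g p< = trans (cong (zigzag q) (τ-involutive (zigzag⁻¹-< (<q p<)))) (zigzag-zigzag⁻¹ (<q p<))

    σ : EdgeLabeling (Spider ys)
    σ = restrict-⤖ f-< g-< g∘f f∘g

    sums : ∀ x → vertexSum (Spider ys) σ x ≡ vertexSumBy lab x
    sums = vertexSum-Spider σ lab (λ e → cong suc (toℕ-restrict-⤖ f-< g-< g∘f f∘g e))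

    vertexSumBy-internal-parity : ∀ {p} → Internal (suc p) → vertexSumBy lab (suc p) ≡ q + residue (parity (τ p))
    vertexSumBy-internal-parity {p} internal@(_ , p+1<q , _) = begin
      vertexSumBy lab (suc p)                                          ≡⟨ vertexSumBy-internal lab p internal ⟩
      zigzagLabel q (τ p) + zigzagLabel q (τ (suc p))
        ≡⟨ cong (λ m → zigzagLabel q m + zigzagLabel q (τ (suc p))) (τ-step internal) ⟩
      zigzagLabel q (suc (τ (suc p))) + zigzagLabel q (τ (suc p))      ≡⟨ zigzagLabel-pair (τ (suc p)) τp<q ⟩
      q + residue (parity (suc (τ (suc p))))                           ≡⟨ cong (λ m → q + residue (parity m)) (τ-step internal) ⟨
      q + residue (parity (τ p))                                       ∎
      where
      open ≡-Reasoning
      τp<q : suc (τ (suc p)) < q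
      τp<q = subst (_< q) (τ-step internal) (τ-< (≤-trans (n≤1+n _) p+1<q))

    lab-positive : ∀ {p} → p < q → 0 < lab p
    lab-positive _ = z<s

    core : ℕ
    core = vertexSumBy lab 0

    heaviestEdge : ℕ
    heaviestEdge = τ 0

    module _ (0<q : 0 < q) where

      lab-heaviestEdge : lab heaviestEdge ≡ q
      lab-heaviestEdge = begin
        zigzagLabel q (τ (τ 0))   ≡⟨ cong (zigzagLabel q) (τ-involutive 0<q) ⟩
        suc (zigzag q 0)          ≡⟨ cong suc (zigzag-even q 0) ⟩
        suc (q ∸ 1)               ≡⟨ m+[n∸m]≡n 0<q ⟩
        q                         ∎
        where open ≡-Reasoning

      heaviestLeaf-∈legEnds : suc heaviestEdge ∈ legEnds 0 ys
      heaviestLeaf-∈legEnds = ¬Internal⇒∈legEnds z<s (τ-< 0<q) λ internal →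
        0≢1+n (trans (sym (τ-involutive 0<q)) (τ-step internal))

      vertexSumBy-heaviestLeaf : vertexSumBy lab (suc heaviestEdge) ≡ q
      vertexSumBy-heaviestLeaf = trans (vertexSumBy-legEnd lab heaviestLeaf-∈legEnds) lab-heaviestEdge

      -- The core, the value q + 1, and the leaves: q itself is the sum at the leaf of the edge labelled q.
      numColors-Scheme-≤ : numColors (Spider ys) σ ≤ suc (suc (length ys))
      numColors-Scheme-≤ = subst (numColors (Spider ys) σ ≤_) (cong (λ d → suc (suc d)) (trans (length-map (vertexSumBy lab) (legEnds 0 ys)) length-legEnds))
        (numColors-≤ (Spider ys) σ vals λ {x} x<1+q → subst (_∈ vals) (sym (sums x)) (covered x (≤-pred x<1+q)))
        where
        vals : List ℕ
        vals = vertexSumBy lab 0 ∷ suc q ∷ map (vertexSumBy lab) (legEnds 0 ys)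
        covered : ∀ x → x ≤ q → vertexSumBy lab x ∈ vals
        covered zero _ = here refl
        covered (suc t) t+1≤q with Internal? (suc t)
        ... | no ¬internal = there (there (∈-map⁺ (vertexSumBy lab) (¬Internal⇒∈legEnds z<s t+1≤q ¬internal)))
        ... | yes internal with parity (τ t) | vertexSumBy-internal-parity internal
        ...   | 1ℙ | sum≡ = there (here (trans sum≡ (+-comm q 1)))
        ...   | 0ℙ | sum≡ = there (there (subst (_∈ _) (trans vertexSumBy-heaviestLeaf (sym (trans sum≡ (+-identityʳ q))))
                              (∈-map⁺ (vertexSumBy lab) heaviestLeaf-∈legEnds)))

    -- The only possible conflict: the core against an internal neighbour.
    Collision : ℕ → Set
    Collision p = parent p ≡ 0 × Internal (suc p) × vertexSumBy lab 0 ≡ vertexSumBy lab (suc p)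

    Collision? : Dec (∃ Collision)
    Collision? = map′ (λ (i , collision) → toℕ i , collision)
      (λ (p , collision) → fromℕ< (p<q collision) , subst Collision (sym (toℕ-fromℕ< (p<q collision))) collision)
      (any? λ i → (parent (toℕ i) ≟ 0) ×-dec Internal? (suc (toℕ i)) ×-dec (vertexSumBy lab 0 ≟ vertexSumBy lab (suc (toℕ i))))
      where
      p<q : ∀ {p} → Collision p → p < q
      p<q (_ , (_ , p+1<q , _) , _) = ≤-trans (n≤1+n _) p+1<q

    adjacentSums-≢ : ¬ ∃ Collision → ∀ {p} → p < q → vertexSumBy lab (parent p) ≢ vertexSumBy lab (suc p)
    adjacentSums-≢ noCollision {p} p<q with Internal? (suc p)
    ... | no ¬internal = λ sums≡ → <⇒≢ (lab<vertexSumBy-parent 2≤d lab lab-positive p<q)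
      (trans (sym (vertexSumBy-legEnd lab (¬Internal⇒∈legEnds z<s p<q ¬internal))) (sym sums≡))
    ... | yes internal with parentFrom-0-or-self 0 ys p
    ...   | inj₁ parent≡0 = λ sums≡ → noCollision (p , parent≡0 , internal , trans (cong (vertexSumBy lab) (sym parent≡0)) sums≡)
    adjacentSums-≢ noCollision {zero} p<q | yes internal | inj₂ parent≡0 =
      λ sums≡ → noCollision (0 , parent≡0 , internal , trans (cong (vertexSumBy lab) (sym parent≡0)) sums≡)
    adjacentSums-≢ noCollision {suc t} p<q | yes internal | inj₂ parent≡p = λ sums≡ →
      parity-suc≢ (τ (suc t)) (trans (cong parity (sym (τ-step t+1-internal)))
        (residue-injective (+-cancelˡ-≡ q _ _ (begin
          q + residue (parity (τ t))          ≡⟨ vertexSumBy-internal-parity t+1-internal ⟨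
          vertexSumBy lab (suc t)             ≡⟨ cong (vertexSumBy lab) parent≡p ⟨
          vertexSumBy lab (parent (suc t))    ≡⟨ sums≡ ⟩
          vertexSumBy lab (suc (suc t))       ≡⟨ vertexSumBy-internal-parity internal ⟩
          q + residue (parity (τ (suc t)))    ∎))))
      where
      open ≡-Reasoning
      t+1-internal : Internal (suc t)
      t+1-internal = z<s , p<q , parent≡p

    antimagic : ¬ ∃ Collision → IsLocalAntimagic (Spider ys) σ
    antimagic noCollision e sums≡ = adjacentSums-≢ noCollision (subst (toℕ e <_) numEdges-Spider (toℕ<n e)) (begin
      vertexSumBy lab (parent (toℕ e))                     ≡⟨ sums _ ⟨
      vertexSum (Spider ys) σ (parent (toℕ e))             ≡⟨ cong (vertexSum (Spider ys) σ ∘ proj₁) (edgeAt-Spider e) ⟨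
      vertexSum (Spider ys) σ (proj₁ (edgeAt (Spider ys) e)) ≡⟨ sums≡ ⟩
      vertexSum (Spider ys) σ (proj₂ (edgeAt (Spider ys) e)) ≡⟨ cong (vertexSum (Spider ys) σ ∘ proj₂) (edgeAt-Spider e) ⟩
      vertexSum (Spider ys) σ (suc (toℕ e))                ≡⟨ sums _ ⟩
      vertexSumBy lab (suc (toℕ e))                        ∎)
      where open ≡-Reasoning

    collision-core : ∀ {p} → Collision p → core ≡ q + residue (parity (τ p))
    collision-core (_ , internal , core≡) = trans core≡ (vertexSumBy-internal-parity internal)

    collision-core-≤ : ∀ {p} → Collision p → core ≤ suc q
    collision-core-≤ {p} collision = begin
      core                          ≡⟨ collision-core collision ⟩
      q + residue (parity (τ p))    ≤⟨ +-monoʳ-≤ q (residue-≤ (parity (τ p))) ⟩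
      q + 1                         ≡⟨ +-comm q 1 ⟩
      suc q                         ∎
      where open ≤-Reasoning

-- Two admissible orderings and why they cannot both fail

legReversal : ℕ → List ℕ → ℕ → ℕ
legReversal off []       p = p
legReversal off (y ∷ ys) p with p <? off + y
... | yes _ = off + (y ∸ suc (p ∸ off))
... | no _  = legReversal (off + y) ys p

legReversal-inside : ∀ off y ys {p} → p < off + y → legReversal off (y ∷ ys) p ≡ off + (y ∸ suc (p ∸ off))
legReversal-inside off y ys {p} p< with p <? off + y
... | yes _ = refl
... | no p≮ = ⊥-elim (p≮ p<)

legReversal-beyond : ∀ off y ys {p} → off + y ≤ p → legReversal off (y ∷ ys) p ≡ legReversal (off + y) ys p
legReversal-beyond off y ys {p} ≤p with p <? off + y
... | yes p< = ⊥-elim (<⇒≱ p< ≤p)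
... | no _   = refl

∸-< : ∀ {off y p} → off ≤ p → p < off + y → p ∸ off < y
∸-< {off} {y} {p} off≤p p< = +-cancelˡ-< off (p ∸ off) y (subst (_< off + y) (sym (m+[n∸m]≡n off≤p)) p<)

legReversal-< : ∀ off ys {p} → off ≤ p → p < off + sum ys → off ≤ legReversal off ys p × legReversal off ys p < off + sum ys
legReversal-< off []       off≤p p< = empty-range off≤p p<
legReversal-< off (y ∷ ys) {p} off≤p p< with p <? off + y
... | yes p<off+y = m≤m+n off _ ,
  ≤-trans (+-monoʳ-< off (∸-suc-< (p ∸ off) (≤-<-trans z≤n (∸-< off≤p p<off+y)))) (+-monoʳ-≤ off (m≤m+n y (sum ys)))
... | no p≮ with legReversal-< (off + y) ys (≮⇒≥ p≮) (<-+-assoc off y ys p<)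
...   | ≤rev , rev< = ≤-trans (m≤m+n off y) ≤rev , ≤-trans rev< (≤-reflexive (+-assoc off y (sum ys)))

legReversal-involutive : ∀ off ys {p} → off ≤ p → p < off + sum ys → legReversal off ys (legReversal off ys p) ≡ p
legReversal-involutive off []       off≤p p< = empty-range off≤p p<
legReversal-involutive off (y ∷ ys) {p} off≤p p< with p <? off + y
... | yes p<off+y = begin
  legReversal off (y ∷ ys) (off + (y ∸ suc j))       ≡⟨ legReversal-inside off y ys (+-monoʳ-< off (∸-suc-< j (≤-<-trans z≤n j<y))) ⟩
  off + (y ∸ suc (off + (y ∸ suc j) ∸ off))          ≡⟨ cong (λ z → off + (y ∸ suc z)) (m+n∸m≡n off _) ⟩
  off + (y ∸ suc (y ∸ suc j))                        ≡⟨ cong (off +_) (∸-suc-involutive j<y) ⟩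
  off + j                                            ≡⟨ m+[n∸m]≡n off≤p ⟩
  p                                                  ∎
  where
  open ≡-Reasoning
  j : ℕ
  j = p ∸ off
  j<y : j < y
  j<y = ∸-< off≤p p<off+y
... | no p≮ = trans (legReversal-beyond off y ys (proj₁ (legReversal-< (off + y) ys off+y≤p p<′)))
                   (legReversal-involutive (off + y) ys off+y≤p p<′)
  where
  off+y≤p : off + y ≤ p
  off+y≤p = ≮⇒≥ p≮
  p<′ : p < off + y + sum ys
  p<′ = <-+-assoc off y ys p<

legReversal-step : ∀ off {ys p} → PositiveLegs ys → off ≤ p → suc p < off + sum ys → parentFrom off ys (suc p) ≡ suc p →
  legReversal off ys p ≡ suc (legReversal off ys (suc p))
legReversal-step off {[]} _ off≤p p+1< _ = empty-range off≤p (≤-trans (n≤1+n _) p+1<)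
legReversal-step off {y ∷ ys} {p} (_ ∷ 1≤ys) off≤p p+1< parent≡ with suc p <? off + y
... | yes p+1<off+y = begin
  legReversal off (y ∷ ys) p               ≡⟨ legReversal-inside off y ys (≤-trans (n≤1+n _) p+1<off+y) ⟩
  off + (y ∸ suc (p ∸ off))
    ≡⟨ cong (off +_) (∸-suc-step (subst (_< y) (+-∸-assoc 1 off≤p) (∸-< (m≤n⇒m≤1+n off≤p) p+1<off+y))) ⟩
  off + suc (y ∸ suc (suc (p ∸ off)))      ≡⟨ +-suc off _ ⟩
  suc (off + (y ∸ suc (suc (p ∸ off))))    ≡⟨ cong (λ j → suc (off + (y ∸ suc j))) (+-∸-assoc 1 off≤p) ⟨
  suc (off + (y ∸ suc (suc p ∸ off)))      ∎
  where open ≡-Reasoning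
... | no p+1≮ with suc p ≟ off + y
...   | yes p+1≡ = ⊥-elim (0≢1+n (begin
  0                                  ≡⟨ parentFrom-next off y 1≤ys (subst (_< off + sum (y ∷ ys)) p+1≡ p+1<) ⟨
  parentFrom off (y ∷ ys) (off + y)  ≡⟨ parentFrom-beyond off y ys ≤-refl ⟩
  parentFrom (off + y) ys (off + y)  ≡⟨ cong (parentFrom (off + y) ys) p+1≡ ⟨
  parentFrom (off + y) ys (suc p)    ≡⟨ parent≡ ⟩
  suc p                              ∎))
  where open ≡-Reasoning
...   | no p+1≢ = trans (legReversal-beyond off y ys off+y≤p)
  (legReversal-step (off + y) 1≤ys off+y≤p (<-+-assoc off y ys p+1<) parent≡)
  where
  off+y≤p : off + y ≤ p
  off+y≤p = ≤-pred (≤∧≢⇒< (≮⇒≥ p+1≮) (p+1≢ ∘ sym))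

legReversal-start : ∀ off {ys o y} → PositiveLegs ys → (o , y) ∈ legsFrom off ys → suc (legReversal off ys o) ≡ o + y
legReversal-start off {zero ∷ _} (() ∷ _) _
legReversal-start off {suc k ∷ ys} _ (here refl) = begin
  suc (legReversal off (suc k ∷ ys) off)       ≡⟨ cong suc (legReversal-inside off (suc k) ys (a<a+1+n off k)) ⟩
  suc (off + (suc k ∸ suc (off ∸ off)))        ≡⟨ cong (λ j → suc (off + (suc k ∸ suc j))) (n∸n≡0 off) ⟩
  suc (off + k)                                ≡⟨ +-suc off k ⟨
  off + suc k                                  ∎
  where open ≡-Reasoning
legReversal-start off {suc k ∷ ys} (_ ∷ 1≤ys) (there leg∈) =
  trans (cong suc (legReversal-beyond off (suc k) ys (proj₁ (legsFrom-bounds (off + suc k) ys leg∈)))) (legReversal-start (off + suc k) 1≤ys leg∈)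

module TwoSchemes (ys : List ℕ) (1≤ys : PositiveLegs ys) (2≤d : 2 ≤ length ys) where

  open SpiderSums ys 1≤ys

  reversal : ℕ → ℕ
  reversal p = q ∸ suc p

  reversal-< : ∀ {p} → p < q → reversal p < q
  reversal-< p<q = ∸-suc-< _ (≤-<-trans z≤n p<q)

  reversal-step : ∀ {p} → Internal (suc p) → reversal p ≡ suc (reversal (suc p))
  reversal-step (_ , p+1<q , _) = ∸-suc-step p+1<q

  legwise : ℕ → ℕ
  legwise = legReversal 0 ys

  legwise-< : ∀ {p} → p < q → legwise p < q
  legwise-< p<q = proj₂ (legReversal-< 0 ys z≤n p<q)

  legwise-involutive : ∀ {p} → p < q → legwise (legwise p) ≡ p
  legwise-involutive = legReversal-involutive 0 ys z≤n

  legwise-step : ∀ {p} → Internal (suc p) → legwise p ≡ suc (legwise (suc p))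
  legwise-step (_ , p+1<q , parent≡) = legReversal-step 0 1≤ys z≤n p+1<q parent≡

  module A = Scheme 2≤d reversal reversal-< ∸-suc-involutive reversal-step
  module B = Scheme 2≤d legwise legwise-< legwise-involutive legwise-step

  reversal-legStart : ∀ {o k} r → o + suc k + r ≡ q → reversal o ≡ k + r
  reversal-legStart {o} {k} r o+1+k+r≡q = begin
    q ∸ suc o                    ≡⟨ cong (_∸ suc o) (trans (sym o+1+k+r≡q) (regroup o k r)) ⟩
    suc o + (k + r) ∸ suc o      ≡⟨ m+n∸m≡n (suc o) (k + r) ⟩
    k + r                        ∎
    where
    open ≡-Reasoning
    regroup : ∀ o k r → o + suc k + r ≡ suc o + (k + r)
    regroup = solve-∀

  legwise-legStart : ∀ {o k} → (o , suc k) ∈ legsFrom 0 ys → legwise o ≡ o + k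
  legwise-legStart {o} {k} leg∈ = suc-injective (trans (legReversal-start 0 1≤ys leg∈) (+-suc o k))

  legTotal : ℕ → ℕ
  legTotal o = doubledLabel q (reversal o) + doubledLabel q (legwise o)

  legTotal-≡ : ∀ {o k} r → (o , suc k) ∈ legsFrom 0 ys → o + suc k + r ≡ q →
    legTotal o ≡ q + suc k + (penalty (parity (k + r)) o + penalty (parity (o + k)) r)
  legTotal-≡ {o} {k} r leg∈ o+1+k+r≡q = begin
    doubledLabel q (reversal o) + doubledLabel q (legwise o)
      ≡⟨ cong₂ (λ m m′ → doubledLabel q m + doubledLabel q m′) (reversal-legStart r o+1+k+r≡q) (legwise-legStart leg∈) ⟩
    doubledLabel q (k + r) + doubledLabel q (o + k)
      ≡⟨ cong₂ _+_ (doubledLabel-≡ o (trans (regroupA o k r) o+1+k+r≡q)) (doubledLabel-≡ r (trans (regroupB o k r) o+1+k+r≡q)) ⟩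
    suc (k + r) + penalty (parity (k + r)) o + (suc (o + k) + penalty (parity (o + k)) r)
      ≡⟨ collect (suc (k + r)) (suc (o + k)) _ _ ⟩
    suc (k + r) + suc (o + k) + (penalty (parity (k + r)) o + penalty (parity (o + k)) r)
      ≡⟨ cong (_+ (penalty (parity (k + r)) o + penalty (parity (o + k)) r)) (trans (regroupC o k r) (cong (_+ suc k) o+1+k+r≡q)) ⟩
    q + suc k + (penalty (parity (k + r)) o + penalty (parity (o + k)) r) ∎
    where
    open ≡-Reasoning
    regroupA : ∀ o k r → k + r + suc o ≡ o + suc k + r
    regroupA = solve-∀
    regroupB : ∀ o k r → o + k + suc r ≡ o + suc k + r
    regroupB = solve-∀
    regroupC : ∀ o k r → suc (k + r) + suc (o + k) ≡ o + suc k + r + suc k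
    regroupC = solve-∀
    collect : ∀ a b c d → a + c + (b + d) ≡ a + b + (c + d)
    collect = solve-∀

  legTotal-≥ : ∀ {o y} → (o , y) ∈ legsFrom 0 ys → q + y ≤ legTotal o
  legTotal-≥ {o} {y} leg∈ with legsFrom-positive 0 1≤ys leg∈
  ... | s≤s {n = k} _ = subst (q + suc k ≤_) (sym (legTotal-≡ r leg∈ (m+[n∸m]≡n (proj₂ (legsFrom-bounds 0 ys leg∈)))))
    (m≤m+n (q + suc k) _)
    where
    r : ℕ
    r = q ∸ (o + suc k)

  sum-legTotal-≡ : sum (map legTotal (legStarts 0 ys)) ≡ (A.core + A.core) + (B.core + B.core)
  sum-legTotal-≡ = begin
    sum (map legTotal starts)                                                    ≡⟨ sum-map-+ doubledA doubledB starts ⟩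
    sum (map doubledA starts) + sum (map doubledB starts)
      ≡⟨ cong₂ _+_ (sum-map-+ A.lab A.lab starts) (sum-map-+ B.lab B.lab starts) ⟩
    (sum (map A.lab starts) + sum (map A.lab starts)) + (sum (map B.lab starts) + sum (map B.lab starts))
      ≡⟨ cong₂ (λ cA cB → (cA + cA) + (cB + cB)) (sym (vertexSumBy-core A.lab)) (sym (vertexSumBy-core B.lab)) ⟩
    (A.core + A.core) + (B.core + B.core)                                        ∎
    where
    open ≡-Reasoning
    starts : List ℕ
    starts = legStarts 0 ys
    doubledA doubledB : ℕ → ℕ
    doubledA o = doubledLabel q (reversal o)
    doubledB o = doubledLabel q (legwise o)

  both-collide-≤ : ∃ A.Collision → ∃ B.Collision → sum (map legTotal (legStarts 0 ys)) ≤ 4 * q + 4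
  both-collide-≤ (_ , collisionA) (_ , collisionB) = begin
    sum (map legTotal (legStarts 0 ys))          ≡⟨ sum-legTotal-≡ ⟩
    (A.core + A.core) + (B.core + B.core)        ≤⟨ +-mono-≤ (+-mono-≤ core-≤A core-≤A) (+-mono-≤ core-≤B core-≤B) ⟩
    (suc q + suc q) + (suc q + suc q)            ≡⟨ four-copies q ⟩
    4 * q + 4                                    ∎
    where
    open ≤-Reasoning
    core-≤A : A.core ≤ suc q
    core-≤A = A.collision-core-≤ collisionA
    core-≤B : B.core ≤ suc q
    core-≤B = B.collision-core-≤ collisionB
    four-copies : ∀ q → (suc q + suc q) + (suc q + suc q) ≡ 4 * q + 4
    four-copies = solve-∀

  sum-legTotal-≥ : length ys * q + q ≤ sum (map legTotal (legStarts 0 ys))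
  sum-legTotal-≥ = begin
    length ys * q + q
      ≡⟨ cong₂ (λ d y → d * q + y) (length-legsFrom 0 ys) (sum-map-proj₂-legsFrom 0 ys) ⟨
    length legs * q + sum (map proj₂ legs)                  ≡⟨ cong (_+ sum (map proj₂ legs)) (sum-map-const q legs) ⟨
    sum (map (λ _ → q) legs) + sum (map proj₂ legs)         ≡⟨ sum-map-+ (λ _ → q) proj₂ legs ⟨
    sum (map (λ (o , y) → q + y) legs)                      ≤⟨ sum-map-mono-≤ legs legTotal-≥ ⟩
    sum (map (legTotal ∘ proj₁) legs)                       ≡⟨ cong sum (map-∘ legs) ⟩
    sum (map legTotal (legStarts 0 ys))                     ∎
    where
    open ≤-Reasoning
    legs : List (ℕ × ℕ)
    legs = legsFrom 0 ys

  -- From four legs on, the legs contribute at least (d + 1) q ≥ 5 q > 4 q + 4 to the two core sums.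
  not-both-collide-≥4 : 4 ≤ length ys → ∃ A.Collision → ∃ B.Collision → ⊥
  not-both-collide-≥4 4≤d collisionA@(_ , _ , internal , _) collisionB = <⇒≱ (begin-strict
    4 * q + 4                                 <⟨ +-monoʳ-< (4 * q) 5≤q ⟩
    4 * q + q                                 ≤⟨ +-monoˡ-≤ q (*-monoˡ-≤ q 4≤d) ⟩
    length ys * q + q                         ≤⟨ sum-legTotal-≥ ⟩
    sum (map legTotal (legStarts 0 ys))       ∎) (both-collide-≤ collisionA collisionB)
    where
    open ≤-Reasoning
    5≤q : 5 ≤ q
    5≤q = ≤-trans (s≤s 4≤d) (Internal⇒length<q internal)

module ThreeLegs (ka kb kc : ℕ) where

  a b c : ℕ
  a = suc ka
  b = suc kb
  c = suc kc

  1≤abc : PositiveLegs (a ∷ b ∷ c ∷ [])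
  1≤abc = s≤s z≤n ∷ s≤s z≤n ∷ s≤s z≤n ∷ []

  open SpiderSums (a ∷ b ∷ c ∷ []) 1≤abc using (q)
  open TwoSchemes (a ∷ b ∷ c ∷ []) 1≤abc (s≤s (s≤s z≤n))

  split₁ : 0 + suc ka + (b + c) ≡ q
  split₁ = cong (λ z → a + (b + z)) (sym (+-identityʳ c))

  split₂ : a + suc kb + c ≡ q
  split₂ = trans (+-assoc a b c) split₁

  split₃ : a + b + suc kc + 0 ≡ q
  split₃ = trans (+-identityʳ (a + b + c)) split₂

  P₁ P₂ P₃ : ℕ
  P₁ = penalty (parity (ka + (b + c))) 0 + penalty (parity ka) (b + c)
  P₂ = penalty (parity (kb + c)) a + penalty (parity (a + kb)) c
  P₃ = penalty (parity (kc + 0)) (a + b) + penalty (parity (a + b + kc)) 0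

  sum-legTotal-≡ₚ : sum (map legTotal (legStarts 0 (a ∷ b ∷ c ∷ []))) ≡ 4 * q + (P₁ + (P₂ + P₃))
  sum-legTotal-≡ₚ = begin
    legTotal 0 + (legTotal a + (legTotal (a + b) + 0))
      ≡⟨ cong₂ _+_ (legTotal-≡ (b + c) (here refl) split₁)
                   (cong₂ _+_ (legTotal-≡ c (there (here refl)) split₂) (cong (_+ 0) (legTotal-≡ 0 (there (there (here refl))) split₃))) ⟩
    q + a + P₁ + (q + b + P₂ + (q + c + P₃ + 0))
      ≡⟨ regroup q a b c P₁ P₂ P₃ ⟩
    3 * q + (a + b + c) + (P₁ + (P₂ + P₃))
      ≡⟨ cong (λ z → 3 * q + z + (P₁ + (P₂ + P₃))) split₂ ⟩
    3 * q + q + (P₁ + (P₂ + P₃))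
      ≡⟨ cong (_+ (P₁ + (P₂ + P₃))) (+-comm (3 * q) q) ⟩
    4 * q + (P₁ + (P₂ + P₃))  ∎
    where
    open ≡-Reasoning
    regroup : ∀ q a b c x y z → q + a + x + (q + b + y + (q + c + z + 0)) ≡ 3 * q + (a + b + c) + (x + (y + z))
    regroup = solve-∀

  module Colliding {pA pB} (collisionA : A.Collision pA) (collisionB : B.Collision pB) where

    rA rB : ℕ
    rA = residue (parity (reversal pA))
    rB = residue (parity (legwise pB))

    penalties-≡ : P₁ + (P₂ + P₃) ≡ (rA + rA) + (rB + rB)
    penalties-≡ = +-cancelˡ-≡ (4 * q) _ _ (begin
      4 * q + (P₁ + (P₂ + P₃))                          ≡⟨ sum-legTotal-≡ₚ ⟨
      sum (map legTotal (legStarts 0 (a ∷ b ∷ c ∷ []))) ≡⟨ sum-legTotal-≡ ⟩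
      (A.core + A.core) + (B.core + B.core)
        ≡⟨ cong₂ (λ x y → (x + x) + (y + y)) (A.collision-core collisionA) (B.collision-core collisionB) ⟩
      (q + rA + (q + rA)) + (q + rB + (q + rB))         ≡⟨ regroup q rA rB ⟩
      4 * q + ((rA + rA) + (rB + rB))                   ∎)
      where
      open ≡-Reasoning
      regroup : ∀ q x y → (q + x + (q + x)) + (q + y + (q + y)) ≡ 4 * q + ((x + x) + (y + y))
      regroup = solve-∀

    penalties-≤ : P₁ + (P₂ + P₃) ≤ 4
    penalties-≤ = subst (_≤ 4) (sym penalties-≡) (+-mono-≤ (+-mono-≤ (rA≤1) (rA≤1)) (+-mono-≤ rB≤1 rB≤1))
      where
      rA≤1 : rA ≤ 1
      rA≤1 = residue-≤ (parity (reversal pA))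
      rB≤1 : rB ≤ 1
      rB≤1 = residue-≤ (parity (legwise pB))

  penalty-even : ∀ m s → parity m ≡ 0ℙ → penalty (parity m) s ≡ suc (s + s)
  penalty-even m s even-m = cong (λ π → penalty π s) even-m

  penalty-odd : ∀ m s → parity m ≡ 1ℙ → penalty (parity m) s ≡ 0
  penalty-odd m s odd-m = cong (λ π → penalty π s) odd-m

  5≤1+2s : ∀ {s} → 2 ≤ s → 5 ≤ suc (s + s)
  5≤1+2s 2≤s = s≤s (+-mono-≤ 2≤s 2≤s)

  ka-even : parity ka ≡ 0ℙ → 5 ≤ P₁ + (P₂ + P₃)
  ka-even even-a = begin
    5                               ≤⟨ 5≤1+2s (+-mono-≤ (s≤s z≤n) (s≤s z≤n)) ⟩
    suc ((b + c) + (b + c))         ≡⟨ penalty-even ka (b + c) even-a ⟨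
    penalty (parity ka) (b + c)     ≤⟨ m≤n+m _ _ ⟩
    P₁                              ≤⟨ m≤m+n P₁ _ ⟩
    P₁ + (P₂ + P₃)                  ∎
    where open ≤-Reasoning

  kc-even : parity kc ≡ 0ℙ → 5 ≤ P₁ + (P₂ + P₃)
  kc-even even-c = begin
    5                                   ≤⟨ 5≤1+2s (+-mono-≤ (s≤s z≤n) (s≤s z≤n)) ⟩
    suc ((a + b) + (a + b))             ≡⟨ penalty-even (kc + 0) (a + b) (parity-+-≡ kc 0 even-c refl) ⟨
    penalty (parity (kc + 0)) (a + b)   ≤⟨ m≤m+n _ _ ⟩
    P₃                                  ≤⟨ m≤n+m P₃ P₂ ⟩
    P₂ + P₃                             ≤⟨ m≤n+m _ P₁ ⟩
    P₁ + (P₂ + P₃)                      ∎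
    where open ≤-Reasoning

  kb-even : parity ka ≡ 1ℙ → parity kb ≡ 0ℙ → parity kc ≡ 1ℙ → 5 ≤ P₁ + (P₂ + P₃)
  kb-even odd-a even-b odd-c = begin
    5                             ≤⟨ +-mono-≤ (s≤s (+-mono-≤ (s≤s z≤n) (s≤s z≤n))) (s≤s (s≤s z≤n)) ⟩
    suc (a + a) + suc (c + c)     ≡⟨ cong₂ _+_ (penalty-even (kb + c) a even-kb+c) (penalty-even (a + kb) c even-a+kb) ⟨
    P₂                            ≤⟨ m≤m+n P₂ P₃ ⟩
    P₂ + P₃                       ≤⟨ m≤n+m _ P₁ ⟩
    P₁ + (P₂ + P₃)                ∎
    where
    open ≤-Reasoning
    even-kb+c : parity (kb + c) ≡ 0ℙ
    even-kb+c = parity-+-≡ kb c even-b (parity-suc-≡ kc odd-c)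
    even-a+kb : parity (a + kb) ≡ 0ℙ
    even-a+kb = parity-+-≡ a kb (parity-suc-≡ ka odd-a) even-b

  module AllOdd (odd-a : parity ka ≡ 1ℙ) (odd-b : parity kb ≡ 1ℙ) (odd-c : parity kc ≡ 1ℙ) where

    odd-ka+[b+c] : parity (ka + (b + c)) ≡ 1ℙ
    odd-ka+[b+c] = parity-+-≡ ka (b + c) odd-a (parity-+-≡ b c (parity-suc-≡ kb odd-b) (parity-suc-≡ kc odd-c))

    odd-kb+c : parity (kb + c) ≡ 1ℙ
    odd-kb+c = parity-+-≡ kb c odd-b (parity-suc-≡ kc odd-c)

    odd-kc+0 : parity (kc + 0) ≡ 1ℙ
    odd-kc+0 = parity-+-≡ kc 0 odd-c refl

    odd-a+kb : parity (a + kb) ≡ 1ℙ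
    odd-a+kb = parity-+-≡ a kb (parity-suc-≡ ka odd-a) odd-b

    odd-a+b+kc : parity (a + b + kc) ≡ 1ℙ
    odd-a+b+kc = parity-+-≡ (a + b) kc (parity-+-≡ a b (parity-suc-≡ ka odd-a) (parity-suc-≡ kb odd-b)) odd-c

    penalties-0 : P₁ + (P₂ + P₃) ≡ 0
    penalties-0 = cong₂ _+_
      (cong₂ _+_ (penalty-odd (ka + (b + c)) 0 odd-ka+[b+c]) (penalty-odd ka (b + c) odd-a))
      (cong₂ _+_ (cong₂ _+_ (penalty-odd (kb + c) a odd-kb+c) (penalty-odd (a + kb) c odd-a+kb))
                 (cong₂ _+_ (penalty-odd (kc + 0) (a + b) odd-kc+0) (penalty-odd (a + b + kc) 0 odd-a+b+kc)))

    reversal-odd : ∀ {p} → p ∈ legStarts 0 (a ∷ b ∷ c ∷ []) → parity (reversal p) ≡ 1ℙ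
    reversal-odd (here refl)                 = trans (cong parity (reversal-legStart {0} {ka} (b + c) split₁)) odd-ka+[b+c]
    reversal-odd (there (here refl))         = trans (cong parity (reversal-legStart {a} {kb} c split₂)) odd-kb+c
    reversal-odd (there (there (here refl))) = trans (cong parity (reversal-legStart {a + b} {kc} 0 split₃)) odd-kc+0

  -- The total penalty is twice the sum of the two residues, hence at most 4. An even ka, kc or kb
  -- already forces a penalty of at least 5; if all three are odd the penalty vanishes, while every
  -- leg start has odd reversal position, so the residue of scheme A is 1.
  not-both-collide-3 : ∃ A.Collision → ∃ B.Collision → ⊥
  not-both-collide-3 (pA , collisionA) (pB , collisionB) = by-parities (parity ka) (parity kb) (parity kc) refl refl refl
    where
    open Colliding collisionA collisionB
    too-many : 5 ≤ P₁ + (P₂ + P₃) → ⊥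
    too-many 5≤ = <⇒≱ 5≤ penalties-≤
    pA-start : pA ∈ legStarts 0 (a ∷ b ∷ c ∷ [])
    pA-start = let (parent≡0 , (_ , pA+1<q , _) , _) = collisionA in
      parentFrom≡0⇒∈legStarts 0 (a ∷ b ∷ c ∷ []) z≤n (≤-trans (n≤1+n _) pA+1<q) parent≡0
    by-parities : ∀ πa πb πc → parity ka ≡ πa → parity kb ≡ πb → parity kc ≡ πc → ⊥
    by-parities 0ℙ _  _  even-a _      _      = too-many (ka-even even-a)
    by-parities 1ℙ _  0ℙ _      _      even-c = too-many (kc-even even-c)
    by-parities 1ℙ 0ℙ 1ℙ odd-a  even-b odd-c  = too-many (kb-even odd-a even-b odd-c)
    by-parities 1ℙ 1ℙ 1ℙ odd-a  odd-b  odd-c  = 1+n≢0 (begin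
      2 + (rB + rB)        ≡⟨ cong (λ π → residue π + residue π + (rB + rB)) (AllOdd.reversal-odd odd-a odd-b odd-c pA-start) ⟨
      (rA + rA) + (rB + rB) ≡⟨ penalties-≡ ⟨
      P₁ + (P₂ + P₃)       ≡⟨ AllOdd.penalties-0 odd-a odd-b odd-c ⟩
      0                    ∎)
      where open ≡-Reasoning

not-both-collide : ∀ ys (1≤ys : PositiveLegs ys) (3≤d : 3 ≤ length ys) →
  ∃ (TwoSchemes.A.Collision ys 1≤ys (≤-trans (n≤1+n 2) 3≤d)) → ∃ (TwoSchemes.B.Collision ys 1≤ys (≤-trans (n≤1+n 2) 3≤d)) → ⊥
not-both-collide (suc ka ∷ suc kb ∷ suc kc ∷ []) (s≤s z≤n ∷ s≤s z≤n ∷ s≤s z≤n ∷ []) _ =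
  ThreeLegs.not-both-collide-3 ka kb kc
not-both-collide ys@(_ ∷ _ ∷ _ ∷ _ ∷ _) 1≤ys 3≤d =
  TwoSchemes.not-both-collide-≥4 ys 1≤ys (≤-trans (n≤1+n 2) 3≤d) (s≤s (s≤s (s≤s (s≤s z≤n))))
not-both-collide [] _ ()
not-both-collide (_ ∷ []) _ (s≤s ())
not-both-collide (_ ∷ _ ∷ []) _ (s≤s (s≤s ()))
not-both-collide (zero ∷ _ ∷ _ ∷ []) (() ∷ _) _
not-both-collide (suc _ ∷ zero ∷ _ ∷ []) (_ ∷ () ∷ _) _
not-both-collide (suc _ ∷ suc _ ∷ zero ∷ []) (_ ∷ _ ∷ () ∷ _) _

module UpperBound (ys : List ℕ) (1≤ys : PositiveLegs ys) (3≤d : 3 ≤ length ys) where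

  open SpiderSums ys 1≤ys using (q)
  open TwoSchemes ys 1≤ys (≤-trans (n≤1+n 2) 3≤d)

  0<q : 0 < q
  0<q = ≤-trans (s≤s z≤n) (≤-trans 3≤d (length≤sum 1≤ys))

  localAntimagic-≤d+2 : Σ (EdgeLabeling (Spider ys)) λ σ → IsLocalAntimagic (Spider ys) σ × numColors (Spider ys) σ ≤ suc (suc (length ys))
  localAntimagic-≤d+2 with A.Collision? | B.Collision?
  ... | no noCollisionA | _                = A.σ , A.antimagic noCollisionA , A.numColors-Scheme-≤ 0<q
  ... | yes _           | no noCollisionB = B.σ , B.antimagic noCollisionB , B.numColors-Scheme-≤ 0<q
  ... | yes collisionA  | yes collisionB  = ⊥-elim (not-both-collide ys 1≤ys 3≤d collisionA collisionB)

corollary2p4 : (ys : List ℕ) → 3 ≤ length ys → PositiveLegs ys →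
    Σ ℕ (λ k → IsChiLa (Spider ys) k × (length ys + 1 ≤ k × k ≤ length ys + 2))
corollary2p4 ys 3≤d 1≤ys = within-bounds (IsChiLa-from-bounds (Spider ys) (suc d) atLeast atMost)
  where
  d : ℕ
  d = length ys

  atLeast : ∀ σ → IsLocalAntimagic (Spider ys) σ → suc d ≤ numColors (Spider ys) σ
  atLeast σ _ = SpiderSums.numColors-Spider-≥ ys 1≤ys (≤-trans (n≤1+n 2) 3≤d) σ

  atMost : Σ (EdgeLabeling (Spider ys)) λ σ → IsLocalAntimagic (Spider ys) σ × numColors (Spider ys) σ ≤ suc (suc d)
  atMost = UpperBound.localAntimagic-≤d+2 ys 1≤ys 3≤d

  within-bounds : IsChiLa (Spider ys) (suc d) ⊎ IsChiLa (Spider ys) (suc (suc d)) →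
    Σ ℕ (λ k → IsChiLa (Spider ys) k × (d + 1 ≤ k × k ≤ d + 2))
  within-bounds (inj₁ χ) = suc d , χ , ≤-reflexive (+-comm d 1) , ≤-trans (n≤1+n (suc d)) (≤-reflexive (+-comm 2 d))
  within-bounds (inj₂ χ) = suc (suc d) , χ , ≤-trans (≤-reflexive (+-comm d 1)) (n≤1+n (suc d)) , ≤-reflexive (+-comm 2 d)
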